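{- Let $\mathrm{inc}(n)$ be the number of increasing permutations of length $n$ and $I(x)=\sum_{n\ge0}\mathrm{inc}(n)\frac{x^n}{n!}$. Then $$I(x)=e^{\frac{3 x}{2} - \frac{1}{4} + \frac{1}{4} e^{2 x}}\left(1-\frac{e^{1/4}}{2}\int_0^x e^{ -\frac{e^{2t}}{4} - \frac{3t}{2}}(1 + e^{2 t})\,dt\right)=1+\frac{x}{1!}+2\frac{x^2}{2!}+6\frac{x^3}{3!}+24\frac{x^4}{4!}+112\frac{x^5}{5!}+584\frac{x^6}{6!}+3376\frac{x^7}{7!}+O(x^8).$$ Moreover $\mathrm{inc}(0)=\mathrm{inc}(1)=1$ and for $n\ge1$, $$\mathrm{inc}(n+1)=2\,\mathrm{inc}(n)+\sum_{i=1}^{n-1}\binom{n}{i}2^{i-1}\mathrm{inc}(n-i).$$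
   Context: A permutation of $[n]$ is written $\pi=\pi_1\cdots\pi_n$; the empty permutation is included for $n=0$. A valley of $\pi$ is an index $\ell$ with $2\le\ell\le n-1$ and $\pi_{\ell-1}>\pi_\ell<\pi_{\ell+1}$; its height is $\pi_\ell$. A permutation is increasing if the heights of its valleys, read from left to right, form an increasing sequence. -}

module Defs where

open import Data.Bool using (Bool; true; false; _∧_; not; if_then_else_)
open import Data.Nat as ℕ using (ℕ; zero; suc; _!; _<ᵇ_; _≡ᵇ_)
open import Data.Nat.Properties using (_!≢0)
open import Data.Fin using (Fin; toℕ)
open import Data.Vec using (Vec; []; _∷_; toList)
open import Data.List using (List; []; _∷_; [_]; map; concatMap; allFin; length)
open import Data.Integer using (+_)
open import Data.Rational using (ℚ; 0ℚ; 1ℚ; _+_; _*_; _-_; -_; _/_)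

allVecs : (len k : ℕ) → List (Vec (Fin k) len)
allVecs zero    k = [ [] ]
allVecs (suc l) k = concatMap (λ i → map (i ∷_) (allVecs l k)) (allFin k)

notElemᵇ : ℕ → List ℕ → Bool
notElemᵇ x []       = true
notElemᵇ x (y ∷ ys) = not (x ≡ᵇ y) ∧ notElemᵇ x ys

distinctᵇ : List ℕ → Bool
distinctᵇ []       = true
distinctᵇ (x ∷ xs) = notElemᵇ x xs ∧ distinctᵇ xs

valleyHeights : List ℕ → List ℕ
valleyHeights (a ∷ tl@(b ∷ c ∷ rest)) =
  if (b <ᵇ a) ∧ (b <ᵇ c) then b ∷ valleyHeights tl else valleyHeights tl
valleyHeights _ = []

increasingᵇ : List ℕ → Bool
increasingᵇ (a ∷ b ∷ rest) = (a <ᵇ b) ∧ increasingᵇ (b ∷ rest)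
increasingᵇ _ = true

-- A permutation of [n] is represented by its one-line word, a vector of
-- length n over Fin n (values 0..n-1 instead of 1..n; shifting all values
-- by one does not affect valleys) with pairwise distinct entries.
isPermᵇ : {n : ℕ} → Vec (Fin n) n → Bool
isPermᵇ v = distinctᵇ (map toℕ (toList v))

isIncreasingPermᵇ : {n : ℕ} → Vec (Fin n) n → Bool
isIncreasingPermᵇ v = isPermᵇ v ∧ increasingᵇ (valleyHeights (map toℕ (toList v)))

countᵇ : {A : Set} → (A → Bool) → List A → ℕ
countᵇ p []       = 0
countᵇ p (x ∷ xs) with p x
... | true  = suc (countᵇ p xs)
... | false = countᵇ p xs

inc : ℕ → ℕ
inc n = countᵇ isIncreasingPermᵇ (allVecs n n)

sumℕ : ℕ → (ℕ → ℕ) → ℕ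
sumℕ zero    f = 0
sumℕ (suc n) f = sumℕ n f ℕ.+ f n

sumℚ : ℕ → (ℕ → ℚ) → ℚ
sumℚ zero    f = 0ℚ
sumℚ (suc n) f = sumℚ n f + f n

-- Formal power series over ℚ, given by their (ordinary) coefficient
-- sequences: F n = [x^n] F.

Series : Set
Series = ℕ → ℚ

const : ℚ → Series
const c zero    = c
const c (suc n) = 0ℚ

linX : ℚ → Series
linX c 1 = c
linX c _ = 0ℚ

_⊕_ : Series → Series → Series
(F ⊕ G) n = F n + G n

_⊖_ : Series → Series → Series
(F ⊖ G) n = F n - G n

scale : ℚ → Series → Series
scale c F n = c * F n

_⊛_ : Series → Series → Series
(F ⊛ G) n = sumℚ (suc n) (λ k → F k * G (n ℕ.∸ k))

pow : Series → ℕ → Series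
pow F zero    = const 1ℚ
pow F (suc k) = F ⊛ pow F k

-- exp(G) = Σ_k G^k / k!  for a series G with zero constant term.
-- (The constant term of G is discarded; we only apply expS to series
-- whose constant term is 0.)  Since G^k has no terms below x^k, the
-- coefficient of x^n only receives contributions from k ≤ n.
expS : Series → Series
expS G n = sumℚ (suc n) (λ k → ((+ 1) / (k !)) {{k !≢0}} * pow G₀ k n)
  where
  G₀ : Series
  G₀ zero    = 0ℚ
  G₀ (suc m) = G (suc m)

integral : Series → Series
integral F zero    = 0ℚ
integral F (suc n) = ((+ 1) / suc n) * F n

Iseries : Series
Iseries n = ((+ inc n) / (n !)) {{n !≢0}}

-- The closed form
--   e^{3x/2 - 1/4 + e^{2x}/4} (1 - (e^{1/4}/2) ∫_0^x e^{-e^{2t}/4 - 3t/2} (1+e^{2t}) dt)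
-- written with the constants e^{∓1/4} absorbed into the exponents:
--   e^{G(x)} (1 - (1/2) ∫_0^x e^{H(t)} (1 + e^{2t}) dt),
--   G(x) = 3x/2 + (e^{2x} - 1)/4,   H(t) = -(e^{2t} - 1)/4 - 3t/2,
-- both with zero constant term.

e2x : Series
e2x = expS (linX ((+ 2) / 1))

Gser : Series
Gser = linX ((+ 3) / 2) ⊕ scale ((+ 1) / 4) (e2x ⊖ const 1ℚ)

Hser : Series
Hser = scale (- ((+ 1) / 4)) (e2x ⊖ const 1ℚ) ⊖ linX ((+ 3) / 2)

closedForm : Series
closedForm = expS Gser ⊛ (const 1ℚ ⊖ scale ((+ 1) / 2) (integral (expS Hser ⊛ (const 1ℚ ⊕ e2x))))

-- Whether the valley heights of a word increase is decided by a left-to-right scan remembering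
-- the last letter, whether it lies below its predecessor, and the last valley height.  Replacing
-- letters by their ranks among the unread letters turns the number of increasing permutations into
-- a recursion on the rank scan alone.  Splitting off the least letter, which is either read last
-- or is the first valley (and then restarts the scan), gives
-- inc (n + 2) = 2 inc (n + 1) + Σ_j C(n + 1, j + 1) 2^j inc (n - j).  For the exponential
-- generating function this is the linear equation I′ = G′ I - (1 + e^{2x}) / 2 with
-- G = 3x/2 + (e^{2x} - 1)/4.  The closed form solves the same equation, because e^G e^{-G} = 1, and
-- both have constant term 1; a first-order linear equation determines every coefficient from the
-- constant term.
module Submission where

open import Defs

module NatSum where

  open import Data.Nat
  open import Data.Nat.Properties
  open import Data.Nat.Solver using (module +-*-Solver)
  open +-*-Solver using (solve; _:+_; _:=_)
  open import Relation.Binary.PropositionalEquality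

  sumℕ-cong : ∀ n {f g : ℕ → ℕ} → (∀ i → f i ≡ g i) → sumℕ n f ≡ sumℕ n g
  sumℕ-cong zero    f≗g = refl
  sumℕ-cong (suc n) f≗g = cong₂ _+_ (sumℕ-cong n f≗g) (f≗g n)

  sumℕ-cong< : ∀ n {f g : ℕ → ℕ} → (∀ i → i < n → f i ≡ g i) → sumℕ n f ≡ sumℕ n g
  sumℕ-cong< zero    f≗g = refl
  sumℕ-cong< (suc n) f≗g =
    cong₂ _+_ (sumℕ-cong< n (λ i i<n → f≗g i (m<n⇒m<1+n i<n))) (f≗g n (n<1+n n))

  sumℕ-zero : ∀ n → sumℕ n (λ _ → 0) ≡ 0
  sumℕ-zero zero    = refl
  sumℕ-zero (suc n) = trans (+-identityʳ _) (sumℕ-zero n)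

  sumℕ-+ : ∀ n (f g : ℕ → ℕ) → sumℕ n (λ i → f i + g i) ≡ sumℕ n f + sumℕ n g
  sumℕ-+ zero    f g = refl
  sumℕ-+ (suc n) f g rewrite sumℕ-+ n f g =
    solve 4 (λ a b c d → (a :+ b) :+ (c :+ d) := (a :+ c) :+ (b :+ d)) refl
      (sumℕ n f) (sumℕ n g) (f n) (g n)

  sumℕ-*ʳ : ∀ n (f : ℕ → ℕ) c → sumℕ n (λ i → f i * c) ≡ sumℕ n f * c
  sumℕ-*ʳ zero    f c = refl
  sumℕ-*ʳ (suc n) f c rewrite sumℕ-*ʳ n f c = sym (*-distribʳ-+ c (sumℕ n f) (f n))

  sumℕ-suc : ∀ n (f : ℕ → ℕ) → sumℕ (suc n) f ≡ f 0 + sumℕ n (λ i → f (suc i))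
  sumℕ-suc zero    f = +-comm 0 (f 0)
  sumℕ-suc (suc n) f rewrite sumℕ-suc n f = +-assoc (f 0) _ _

  sumℕ-split : ∀ {a n} → a ≤ n → (f : ℕ → ℕ) →
               sumℕ n f ≡ sumℕ a f + sumℕ (n ∸ a) (λ t → f (a + t))
  sumℕ-split {a} {n} a≤n f = trans (cong (λ m → sumℕ m f) (sym (m+[n∸m]≡n a≤n))) (split a (n ∸ a))
    where
    split : ∀ a b → sumℕ (a + b) f ≡ sumℕ a f + sumℕ b (λ t → f (a + t))
    split a zero    rewrite +-identityʳ a = sym (+-identityʳ _)
    split a (suc b) rewrite +-suc a b | split a b = +-assoc (sumℕ a f) _ _

  sumℕ-swap : ∀ a b (h : ℕ → ℕ → ℕ) →
              sumℕ a (λ s → sumℕ b (h s)) ≡ sumℕ b (λ j → sumℕ a (λ s → h s j))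
  sumℕ-swap zero    b h = sym (sumℕ-zero b)
  sumℕ-swap (suc a) b h rewrite sumℕ-swap a b h =
    sym (sumℕ-+ b (λ j → sumℕ a (λ s → h s j)) (λ j → h a j))

module Binomial where

  open import Data.Nat
  open import Data.Nat.Properties
  open import Data.Nat.Combinatorics using (_C_; nCk+nC[k+1]≡[n+1]C[k+1])
  open import Relation.Binary.PropositionalEquality

  binom : ℕ → ℕ → ℕ
  binom zero    zero    = 1
  binom zero    (suc k) = 0
  binom (suc n) zero    = 1
  binom (suc n) (suc k) = binom n k + binom n (suc k)

  binom-zero : ∀ n → binom n 0 ≡ 1
  binom-zero zero    = refl
  binom-zero (suc n) = refl

  binom-one : ∀ n → binom n 1 ≡ n
  binom-one zero    = refl
  binom-one (suc n) rewrite binom-zero n | binom-one n = refl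

  sumℕ-binom : ∀ r j → sumℕ r (λ s → binom s j) ≡ binom r (suc j)
  sumℕ-binom zero    j = refl
  sumℕ-binom (suc r) j rewrite sumℕ-binom r j = +-comm (binom r (suc j)) (binom r j)

  binom≡C : ∀ n k → binom n k ≡ n C k
  binom≡C zero    zero    = refl
  binom≡C zero    (suc k) = refl
  binom≡C (suc n) zero    = refl
  binom≡C (suc n) (suc k) rewrite binom≡C n k | binom≡C n (suc k) = nCk+nC[k+1]≡[n+1]C[k+1] n k

module BoolReflect where

  open import Data.Nat
  open import Data.Nat.Properties
  open import Data.Bool using (Bool; true; false)
  open import Data.Bool.Properties using (T-≡)
  open import Function.Bundles using (Equivalence)
  open import Relation.Binary.PropositionalEquality
  open import Relation.Nullary using (contradiction)
  open Equivalence using (to; from)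

  <ᵇ-true : ∀ {m n} → m < n → (m <ᵇ n) ≡ true
  <ᵇ-true m<n = to T-≡ (<⇒<ᵇ m<n)

  <ᵇ-false : ∀ {m n} → n ≤ m → (m <ᵇ n) ≡ false
  <ᵇ-false {m} {n} n≤m with m <ᵇ n in eq
  ... | false = refl
  ... | true  = contradiction (<ᵇ⇒< m n (from T-≡ eq)) (≤⇒≯ n≤m)

  ≤ᵇ-true : ∀ {m n} → m ≤ n → (m ≤ᵇ n) ≡ true
  ≤ᵇ-true m≤n = to T-≡ (≤⇒≤ᵇ m≤n)

  ≤ᵇ-false : ∀ {m n} → n < m → (m ≤ᵇ n) ≡ false
  ≤ᵇ-false {m} {n} n<m with m ≤ᵇ n in eq
  ... | false = refl
  ... | true  = contradiction (≤ᵇ⇒≤ m n (from T-≡ eq)) (<⇒≱ n<m)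

  <ᵇ-true⇒< : ∀ {m n} → (m <ᵇ n) ≡ true → m < n
  <ᵇ-true⇒< {m} {n} eq = <ᵇ⇒< m n (from T-≡ eq)

  ≤ᵇ-true⇒≤ : ∀ {m n} → (m ≤ᵇ n) ≡ true → m ≤ n
  ≤ᵇ-true⇒≤ {m} {n} eq = ≤ᵇ⇒≤ m n (from T-≡ eq)

  ≡ᵇ-refl : ∀ x → (x ≡ᵇ x) ≡ true
  ≡ᵇ-refl x = to T-≡ (≡⇒≡ᵇ x x refl)

  ≡ᵇ-false : ∀ {x y} → x ≢ y → (x ≡ᵇ y) ≡ false
  ≡ᵇ-false {x} {y} x≢y with x ≡ᵇ y in eq
  ... | false = refl
  ... | true  = contradiction (≡ᵇ⇒≡ x y (from T-≡ eq)) x≢y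

  ≡ᵇ-sym : ∀ a b → (a ≡ᵇ b) ≡ (b ≡ᵇ a)
  ≡ᵇ-sym zero    zero    = refl
  ≡ᵇ-sym zero    (suc b) = refl
  ≡ᵇ-sym (suc a) zero    = refl
  ≡ᵇ-sym (suc a) (suc b) = ≡ᵇ-sym a b

module Counting where

  open import Data.Nat
  open import Data.Bool using (Bool; true; false; _∧_; if_then_else_)
  open import Data.List using (List; []; _∷_; [_]; map; concatMap; _++_; allFin; tabulate)
  open import Data.Nat.ListAction using (sum)
  open import Data.List.Properties using (map-tabulate; map-cong)
  open import Data.Vec using (Vec; toList) renaming (_∷_ to _∷ᵥ_)
  open import Data.Fin using (Fin; toℕ)
  open import Function using (id)
  open import Relation.Binary.PropositionalEquality hiding ([_])
  open ≡-Reasoning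
  open NatSum

  sum-tabulate-toℕ : ∀ k (h : ℕ → ℕ) → sum (tabulate (λ (i : Fin k) → h (toℕ i))) ≡ sumℕ k h
  sum-tabulate-toℕ zero    h = refl
  sum-tabulate-toℕ (suc k) h =
    trans (cong (h 0 +_) (sum-tabulate-toℕ k (λ i → h (suc i)))) (sym (sumℕ-suc k h))

  sum-map-allFin : ∀ k (h : ℕ → ℕ) → sum (map (λ i → h (toℕ i)) (allFin k)) ≡ sumℕ k h
  sum-map-allFin k h = trans (cong sum (map-tabulate {n = k} id (λ i → h (toℕ i)))) (sum-tabulate-toℕ k h)

  variable
    A B : Set

  countᵇ-++ : ∀ (P : A → Bool) xs ys → countᵇ P (xs ++ ys) ≡ countᵇ P xs + countᵇ P ys
  countᵇ-++ P []       ys = refl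
  countᵇ-++ P (x ∷ xs) ys with P x
  ... | true  = cong suc (countᵇ-++ P xs ys)
  ... | false = countᵇ-++ P xs ys

  countᵇ-map : ∀ (P : B → Bool) (f : A → B) xs →
               countᵇ P (map f xs) ≡ countᵇ (λ x → P (f x)) xs
  countᵇ-map P f []       = refl
  countᵇ-map P f (x ∷ xs) with P (f x)
  ... | true  = cong suc (countᵇ-map P f xs)
  ... | false = countᵇ-map P f xs

  countᵇ-concatMap : ∀ (P : B → Bool) (g : A → List B) xs →
                     countᵇ P (concatMap g xs) ≡ sum (map (λ x → countᵇ P (g x)) xs)
  countᵇ-concatMap P g []       = refl
  countᵇ-concatMap P g (x ∷ xs) =
    trans (countᵇ-++ P (g x) (concatMap g xs)) (cong (countᵇ P (g x) +_) (countᵇ-concatMap P g xs))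

  countᵇ-cong : ∀ {P Q : A → Bool} xs → (∀ x → P x ≡ Q x) → countᵇ P xs ≡ countᵇ Q xs
  countᵇ-cong []       P≗Q = refl
  countᵇ-cong {P = P} {Q} (x ∷ xs) P≗Q with P x | Q x | P≗Q x
  ... | true  | true  | refl = cong suc (countᵇ-cong xs P≗Q)
  ... | false | false | refl = countᵇ-cong xs P≗Q

  countᵇ-guard : ∀ b (Q : A → Bool) xs → countᵇ (λ w → b ∧ Q w) xs ≡ (if b then countᵇ Q xs else 0)
  countᵇ-guard true  Q xs       = refl
  countᵇ-guard false Q []       = refl
  countᵇ-guard false Q (x ∷ xs) = countᵇ-guard false Q xs

  words : ℕ → ℕ → List (List ℕ)
  words zero    k = [ [] ]
  words (suc l) k = concatMap (λ i → map (toℕ i ∷_) (words l k)) (allFin k)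

  toWord : ∀ {l k} → Vec (Fin k) l → List ℕ
  toWord v = map toℕ (toList v)

  countᵇ-allVecs : ∀ l k (P : List ℕ → Bool) →
                   countᵇ (λ (v : Vec (Fin k) l) → P (toWord v)) (allVecs l k) ≡ countᵇ P (words l k)
  countᵇ-allVecs zero k P with P []
  ... | true  = refl
  ... | false = refl
  countᵇ-allVecs (suc l) k P = begin
    countᵇ (λ v → P (toWord v)) (allVecs (suc l) k)
      ≡⟨ countᵇ-concatMap _ (λ i → map (i ∷ᵥ_) (allVecs l k)) (allFin k) ⟩
    sum (map (λ i → countᵇ (λ v → P (toWord v)) (map (i ∷ᵥ_) (allVecs l k))) (allFin k))
      ≡⟨ cong sum (map-cong (λ i → trans (countᵇ-map _ (i ∷ᵥ_) (allVecs l k))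
                            (trans (countᵇ-allVecs l k (λ w → P (toℕ i ∷ w)))
                                   (sym (countᵇ-map P (toℕ i ∷_) (words l k))))) (allFin k)) ⟩
    sum (map (λ i → countᵇ P (map (toℕ i ∷_) (words l k))) (allFin k))
      ≡⟨ sym (countᵇ-concatMap P (λ i → map (toℕ i ∷_) (words l k)) (allFin k)) ⟩
    countᵇ P (words (suc l) k) ∎

module ValleyScan where

  open import Data.Nat
  open import Data.Nat.Properties using (<⇒≤)
  open import Data.Bool using (Bool; true; false; _∧_; not; if_then_else_)
  open import Data.Bool.Properties using (∧-commutativeMonoid; ∧-conicalʳ)
  open import Algebra.Solver.CommutativeMonoid ∧-commutativeMonoid using (solve; _⊜_) renaming (_⊕_ to _∧′_)
  open import Data.Maybe using (Maybe; just; nothing)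
  open import Data.List using (List; []; _∷_; map; allFin)
  open import Data.List.Properties using (map-cong)
  open import Data.Nat.ListAction using (sum)
  open import Data.Fin using (toℕ)
  open import Relation.Binary.PropositionalEquality
  open BoolReflect
  open Counting

  -- at p falling v above: p is the last letter read, falling says that p lies below its
  -- predecessor (so p becomes a valley if the next letter is larger), v is the height of
  -- the last valley and above says whether p > v, i.e. whether p may be the next valley.
  data Scan : Set where
    start : Scan
    at    : ℕ → Bool → Maybe ℕ → Bool → Scan

  above : Maybe ℕ → ℕ → Bool
  above nothing  x = true
  above (just v) x = v <ᵇ x

  admits : Scan → ℕ → Bool
  admits start         x = true
  admits (at p d v ok) x = if d ∧ (p <ᵇ x) then ok else true

  step : Scan → ℕ → Scan
  step start         x = at x false nothing true
  step (at p d v ok) x =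
    if d ∧ (p <ᵇ x) then at x false (just p) true else at x (x <ᵇ p) v (above v x)

  scan : Scan → List ℕ → Bool
  scan σ []      = true
  scan σ (x ∷ w) = admits σ x ∧ scan (step σ x) w

  increasingAbove : Maybe ℕ → List ℕ → Bool
  increasingAbove nothing  hs = increasingᵇ hs
  increasingAbove (just v) hs = increasingᵇ (v ∷ hs)

  increasingAbove-∷ : ∀ v b hs → (above v b ∧ increasingᵇ (b ∷ hs)) ≡ increasingAbove v (b ∷ hs)
  increasingAbove-∷ nothing  b hs = refl
  increasingAbove-∷ (just v) b hs = refl

  scan-at : ∀ v a b rest →
            scan (at b (b <ᵇ a) v (above v b)) rest ≡ increasingAbove v (valleyHeights (a ∷ b ∷ rest))
  scan-at nothing  a b []      = refl
  scan-at (just v) a b []      = refl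
  scan-at v a b (c ∷ rest) with (b <ᵇ a) ∧ (b <ᵇ c) in valley
  ... | false = scan-at v b c rest
  ... | true  = begin
    above v b ∧ scan (at c false (just b) true) rest
      ≡⟨ cong₂ (λ d ok → above v b ∧ scan (at c d (just b) ok) rest)
               (sym (<ᵇ-false (<⇒≤ b<c))) (sym (<ᵇ-true b<c)) ⟩
    above v b ∧ scan (at c (c <ᵇ b) (just b) (b <ᵇ c)) rest
      ≡⟨ cong (above v b ∧_) (scan-at (just b) b c rest) ⟩
    above v b ∧ increasingᵇ (b ∷ valleyHeights (b ∷ c ∷ rest))
      ≡⟨ increasingAbove-∷ v b _ ⟩
    increasingAbove v (b ∷ valleyHeights (b ∷ c ∷ rest)) ∎
    where
    open ≡-Reasoning
    b<c : b < c
    b<c = <ᵇ-true⇒< (∧-conicalʳ (b <ᵇ a) _ valley)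

  scan-start : ∀ w → scan start w ≡ increasingᵇ (valleyHeights w)
  scan-start []             = refl
  scan-start (a ∷ [])       = refl
  scan-start (a ∷ b ∷ rest) = scan-at nothing a b rest

  freeOf : List ℕ → List ℕ → Bool
  freeOf U []      = true
  freeOf U (z ∷ w) = notElemᵇ z U ∧ freeOf U w

  freeOf-[] : ∀ w → freeOf [] w ≡ true
  freeOf-[] []      = refl
  freeOf-[] (z ∷ w) = freeOf-[] w

  freeOf-∷ : ∀ x U w → freeOf (x ∷ U) w ≡ (notElemᵇ x w ∧ freeOf U w)
  freeOf-∷ x U []      = refl
  freeOf-∷ x U (z ∷ w) rewrite freeOf-∷ x U w | ≡ᵇ-sym z x =
    solve 4 (λ a b c d → (a ∧′ b) ∧′ (c ∧′ d) ⊜ (a ∧′ c) ∧′ (b ∧′ d)) refl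
      (not (x ≡ᵇ z)) (notElemᵇ z U) (notElemᵇ x w) (freeOf U w)

  accepted : ℕ → ℕ → List ℕ → Scan → ℕ
  accepted l k U σ = countᵇ (λ w → distinctᵇ w ∧ (freeOf U w ∧ scan σ w)) (words l k)

  inc≡accepted : ∀ n → inc n ≡ accepted n n [] start
  inc≡accepted n =
    trans (countᵇ-allVecs n n (λ w → distinctᵇ w ∧ increasingᵇ (valleyHeights w)))
          (countᵇ-cong (words n n) (λ w → cong (distinctᵇ w ∧_)
            (sym (cong₂ _∧_ (freeOf-[] w) (scan-start w)))))

  accepted-suc : ∀ l k U σ → accepted (suc l) k U σ ≡
    sumℕ k (λ x → if notElemᵇ x U ∧ admits σ x then accepted l k (x ∷ U) (step σ x) else 0)
  accepted-suc l k U σ =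
    trans (countᵇ-concatMap P (λ i → map (toℕ i ∷_) (words l k)) (allFin k))
    (trans (cong sum (map-cong (λ i → trans (countᵇ-map P (toℕ i ∷_) (words l k))
              (trans (countᵇ-cong (words l k) (first-letter (toℕ i))) (countᵇ-guard _ _ (words l k))))
              (allFin k)))
           (sum-map-allFin k _))
    where
    P : List ℕ → Bool
    P w = distinctᵇ w ∧ (freeOf U w ∧ scan σ w)
    first-letter : ∀ x w → P (x ∷ w) ≡
      ((notElemᵇ x U ∧ admits σ x) ∧ (distinctᵇ w ∧ (freeOf (x ∷ U) w ∧ scan (step σ x) w)))
    first-letter x w rewrite freeOf-∷ x U w =
      solve 6 (λ a b c d e g → (a ∧′ b) ∧′ ((c ∧′ d) ∧′ (e ∧′ g)) ⊜ (c ∧′ e) ∧′ (b ∧′ ((a ∧′ d) ∧′ g)))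
        refl (notElemᵇ x w) (distinctᵇ w) (notElemᵇ x U) (freeOf U w) (admits σ x) (scan (step σ x) w)

-- The same scan run on ranks: a letter still to be read is represented by its rank among the
-- unread letters, a letter already read by the number of unread letters below it.  For a read
-- letter y and an unread x, y < x then becomes rank y ≤ rank x, and reading x lowers by one
-- the ranks of the stored letters above x.
module RankScan where

  open import Data.Nat
  open import Data.Nat.Properties
  open import Data.Bool using (Bool; true; false; _∧_; if_then_else_)
  open import Data.Maybe using (Maybe; just; nothing; map; is-nothing)
  open import Data.Unit using (⊤; tt)
  open import Data.Empty using (⊥)
  open import Relation.Binary.PropositionalEquality
  open ≡-Reasoning
  open NatSum
  open ValleyScan using (Scan; start; at)

  lowerPast : ℕ → ℕ → ℕ
  lowerPast r k = if r <ᵇ k then pred k else k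

  aboveRank : Maybe ℕ → ℕ → Bool
  aboveRank nothing  r = true
  aboveRank (just k) r = k ≤ᵇ r

  rankAdmits : Scan → ℕ → Bool
  rankAdmits start         r = true
  rankAdmits (at p d v ok) r = if d ∧ (p ≤ᵇ r) then ok else true

  rankStep : Scan → ℕ → Scan
  rankStep start         r = at r false nothing true
  rankStep (at p d v ok) r =
    if d ∧ (p ≤ᵇ r) then at r false (just p) true
    else at r (r <ᵇ p) (map (lowerPast r) v) (aboveRank v r)

  completions : ℕ → Scan → ℕ
  completions zero    σ = 1
  completions (suc m) σ =
    sumℕ (suc m) (λ r → if rankAdmits σ r then completions m (rankStep σ r) else 0)

  shift : Scan → Scan
  shift start         = start
  shift (at p d v ok) = at (suc p) d (map suc v) ok

  IsAt : Scan → Set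
  IsAt start         = ⊥
  IsAt (at _ _ _ _) = ⊤

  rankStep-isAt : ∀ σ r → IsAt (rankStep σ r)
  rankStep-isAt start         r = tt
  rankStep-isAt (at p d v ok) r with d ∧ (p ≤ᵇ r)
  ... | true  = tt
  ... | false = tt

  ≤ᵇ-suc : ∀ p r → (suc p ≤ᵇ suc r) ≡ (p ≤ᵇ r)
  ≤ᵇ-suc zero    r = refl
  ≤ᵇ-suc (suc p) r = refl

  rankAdmits-shift : ∀ σ r → rankAdmits (shift σ) (suc r) ≡ rankAdmits σ r
  rankAdmits-shift start         r = refl
  rankAdmits-shift (at p d v ok) r rewrite ≤ᵇ-suc p r = refl

  rankStep-shift : ∀ σ r → rankStep (shift σ) (suc r) ≡ shift (rankStep σ r)
  rankStep-shift start         r = refl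
  rankStep-shift (at p d v ok) r rewrite ≤ᵇ-suc p r with d ∧ (p ≤ᵇ r)
  ... | true  = refl
  ... | false = cong₂ (at (suc r) (r <ᵇ p)) (lower-shift v) (above-shift v)
    where
    lower-shift : ∀ v → map (lowerPast (suc r)) (map suc v) ≡ map suc (map (lowerPast r) v)
    lower-shift nothing        = refl
    lower-shift (just zero)    = refl
    lower-shift (just (suc k)) with r <ᵇ suc k
    ... | true  = refl
    ... | false = refl
    above-shift : ∀ v → aboveRank (map suc v) (suc r) ≡ aboveRank v r
    above-shift nothing  = refl
    above-shift (just k) = ≤ᵇ-suc k r

  completions-valley-rank0 : ∀ m p d ok →
    completions m (at p d (just 0) ok) ≡ completions m (at p d nothing ok)
  completions-valley-rank0 zero    p d ok = refl
  completions-valley-rank0 (suc m) p d ok = sumℕ-cong (suc m) next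
    where
    next : ∀ r → (if rankAdmits (at p d (just 0) ok) r then completions m (rankStep (at p d (just 0) ok) r) else 0)
               ≡ (if rankAdmits (at p d nothing ok) r then completions m (rankStep (at p d nothing ok) r) else 0)
    next r with d ∧ (p ≤ᵇ r)
    ... | true  = refl
    ... | false = completions-valley-rank0 m r (r <ᵇ p) true

  noValleyYet : Scan → ℕ
  noValleyYet (at _ _ nothing _) = 1
  noValleyYet _                  = 0

  -- A least letter read now is a valley unless it is last; it is then the lowest valley, so it is
  -- admissible only if no valley was seen before, and it restarts the scan.
  completions-afterLeast : ∀ m p d v ok →
    completions (suc m) (at 0 true v (is-nothing v)) ≡ noValleyYet (at p d v ok) * completions (suc m) start
  completions-afterLeast m p d nothing  ok =
    trans (sumℕ-cong (suc m) (λ r → completions-valley-rank0 m r false true)) (sym (+-identityʳ _))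
  completions-afterLeast m p d (just k) ok = sumℕ-zero (suc m)

  -- innerMin m σ counts the completions of σ by its m remaining letters together with
  -- one extra letter below all of them that is not read last.
  innerMin : ℕ → Scan → ℕ
  innerMin zero    σ = 0
  innerMin (suc m) σ =
    noValleyYet σ * completions (suc m) start
    + sumℕ (suc m) (λ r → if rankAdmits σ r then innerMin m (rankStep σ r) else 0)

  read-least : ∀ m p d v ok →
    (if rankAdmits (shift (at p d v ok)) 0 then completions m (rankStep (shift (at p d v ok)) 0) else 0)
    ≡ completions m (at 0 true v (is-nothing v))
  read-least m p true  nothing  ok = refl
  read-least m p true  (just x) ok = refl
  read-least m p false nothing  ok = refl
  read-least m p false (just x) ok = refl

  if-+ : ∀ c a b → (if c then a + b else 0) ≡ (if c then a else 0) + (if c then b else 0)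
  if-+ true  a b = refl
  if-+ false a b = refl

  -- shift σ has one more unread letter, below all the others; it is read either last or not.
  completions-shift : ∀ m σ → IsAt σ →
    completions (suc m) (shift σ) ≡ completions m σ + innerMin m σ
  completions-shift zero    (at p d v ok) _ = cong (0 +_) (read-least 0 p d v ok)
  completions-shift (suc m) σ@(at p d v ok) _ = begin
    completions (suc (suc m)) (shift σ)
      ≡⟨ sumℕ-suc (suc m) _ ⟩
    (if rankAdmits (shift σ) 0 then completions (suc m) (rankStep (shift σ) 0) else 0)
      + sumℕ (suc m) (λ r → if rankAdmits (shift σ) (suc r) then completions (suc m) (rankStep (shift σ) (suc r)) else 0)
      ≡⟨ cong₂ _+_ (trans (read-least (suc m) p d v ok) (completions-afterLeast m p d v ok))
                   (trans (sumℕ-cong (suc m) later) (sumℕ-+ (suc m) _ _)) ⟩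
    L + (completions (suc m) σ + R)
      ≡⟨ sym (+-assoc L _ R) ⟩
    L + completions (suc m) σ + R
      ≡⟨ cong (_+ R) (+-comm L _) ⟩
    completions (suc m) σ + L + R
      ≡⟨ +-assoc (completions (suc m) σ) L R ⟩
    completions (suc m) σ + innerMin (suc m) σ ∎
    where
    L = noValleyYet σ * completions (suc m) start
    R = sumℕ (suc m) (λ r → if rankAdmits σ r then innerMin m (rankStep σ r) else 0)
    later : ∀ r → (if rankAdmits (shift σ) (suc r) then completions (suc m) (rankStep (shift σ) (suc r)) else 0)
                ≡ (if rankAdmits σ r then completions m (rankStep σ r) else 0)
                  + (if rankAdmits σ r then innerMin m (rankStep σ r) else 0)
    later r rewrite rankAdmits-shift σ r | rankStep-shift σ r
                  | completions-shift m (rankStep σ r) (rankStep-isAt σ r) = if-+ (rankAdmits σ r) _ _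

module Standardisation where

  open import Data.Nat
  open import Data.Nat.Properties
  open import Data.Bool using (Bool; true; false; _∧_; not; if_then_else_)
  open import Data.Bool.Properties using (∧-zeroʳ; ∧-conicalʳ)
  open import Data.Maybe using (Maybe; just; nothing; map)
  open import Data.List using (List; []; _∷_)
  open import Data.Product using (_×_; _,_)
  open import Data.Unit using (⊤; tt)
  open import Data.Sum using (inj₁; inj₂)
  open import Relation.Binary.Definitions using (tri<; tri≈; tri>)
  open import Relation.Binary.PropositionalEquality
  open import Relation.Nullary using (contradiction)
  open NatSum
  open BoolReflect
  open ValleyScan
  open RankScan

  rank : ℕ → List ℕ → ℕ
  rank y U = sumℕ y (λ z → if notElemᵇ z U then 1 else 0)

  rank-[] : ∀ n → rank n [] ≡ n
  rank-[] zero    = refl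
  rank-[] (suc n) rewrite rank-[] n = +-comm n 1

  rank-mono : ∀ U {a b} → a ≤ b → rank a U ≤ rank b U
  rank-mono U {a} {zero}  z≤n = ≤-refl
  rank-mono U {a} {suc b} a≤b with m≤n⇒m<n∨m≡n a≤b
  ... | inj₁ a<1+b = ≤-trans (rank-mono U (≤-pred a<1+b)) (m≤m+n (rank b U) _)
  ... | inj₂ refl  = ≤-refl

  rank-< : ∀ U {x y} → notElemᵇ x U ≡ true → x < y → rank x U < rank y U
  rank-< U {x} {y} x∉U x<y =
    subst (_≤ rank y U) (trans (cong (λ b → rank x U + (if b then 1 else 0)) x∉U) (+-comm (rank x U) 1))
          (rank-mono U x<y)

  sumℕ-rank : ∀ U k (G : ℕ → ℕ) →
              sumℕ k (λ x → if notElemᵇ x U then G (rank x U) else 0) ≡ sumℕ (rank k U) G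
  sumℕ-rank U zero    G = refl
  sumℕ-rank U (suc k) G with notElemᵇ k U
  ... | true  rewrite +-comm (rank k U) 1 = cong (_+ G (rank k U)) (sumℕ-rank U k G)
  ... | false rewrite +-identityʳ (rank k U) = trans (+-identityʳ _) (sumℕ-rank U k G)

  toRanks : List ℕ → Scan → Scan
  toRanks U start         = start
  toRanks U (at p d v ok) = at (rank p U) d (map (λ y → rank y U) v) ok

  ValleyRead : List ℕ → Maybe ℕ → Set
  ValleyRead U nothing  = ⊤
  ValleyRead U (just y) = notElemᵇ y U ≡ false

  StoresRead : List ℕ → Scan → Set
  StoresRead U start         = ⊤
  StoresRead U (at p d v ok) = (notElemᵇ p U ≡ false) × ValleyRead U v

  module _ {x : ℕ} {U : List ℕ} (x∉U : notElemᵇ x U ≡ true) where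

    read≢x : ∀ {y} → notElemᵇ y U ≡ false → y ≢ x
    read≢x y∈U refl with () ← trans (sym x∉U) y∈U

    <ᵇ-rank : ∀ y → notElemᵇ y U ≡ false → (y <ᵇ x) ≡ (rank y U ≤ᵇ rank x U)
    <ᵇ-rank y y∈U with <-cmp y x
    ... | tri< y<x _ _ = trans (<ᵇ-true y<x) (sym (≤ᵇ-true (rank-mono U (<⇒≤ y<x))))
    ... | tri≈ _ y≡x _ = contradiction y≡x (read≢x y∈U)
    ... | tri> _ _ x<y = trans (<ᵇ-false (<⇒≤ x<y)) (sym (≤ᵇ-false (rank-< U x∉U x<y)))

    rank-<ᵇ : ∀ y → notElemᵇ y U ≡ false → (x <ᵇ y) ≡ (rank x U <ᵇ rank y U)
    rank-<ᵇ y y∈U with <-cmp y x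
    ... | tri< y<x _ _ = trans (<ᵇ-false (<⇒≤ y<x)) (sym (<ᵇ-false (rank-mono U (<⇒≤ y<x))))
    ... | tri≈ _ y≡x _ = contradiction y≡x (read≢x y∈U)
    ... | tri> _ _ x<y = trans (<ᵇ-true x<y) (sym (<ᵇ-true (rank-< U x∉U x<y)))

    rank-∷-≤ : ∀ y → y ≤ x → rank y (x ∷ U) ≡ rank y U
    rank-∷-≤ zero    _   = refl
    rank-∷-≤ (suc y) y<x rewrite ≡ᵇ-false (<⇒≢ y<x) =
      cong (_+ (if notElemᵇ y U then 1 else 0)) (rank-∷-≤ y (<⇒≤ y<x))

    rank-∷-> : ∀ y → x < y → suc (rank y (x ∷ U)) ≡ rank y U
    rank-∷-> (suc y) x<1+y with m≤n⇒m<n∨m≡n (≤-pred x<1+y)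
    ... | inj₁ x<y rewrite ≡ᵇ-false (>⇒≢ x<y) =
      cong (_+ (if notElemᵇ y U then 1 else 0)) (rank-∷-> y x<y)
    ... | inj₂ refl rewrite ≡ᵇ-refl x | x∉U | rank-∷-≤ x ≤-refl =
      trans (cong suc (+-identityʳ _)) (+-comm 1 (rank x U))

    rank-∷-read : ∀ y → notElemᵇ y U ≡ false → rank y (x ∷ U) ≡ lowerPast (rank x U) (rank y U)
    rank-∷-read y y∈U with <-cmp y x
    ... | tri< y<x _ _ rewrite <ᵇ-false {rank x U} (rank-mono U (<⇒≤ y<x)) = rank-∷-≤ y (<⇒≤ y<x)
    ... | tri≈ _ y≡x _ = contradiction y≡x (read≢x y∈U)
    ... | tri> _ _ x<y rewrite <ᵇ-true (rank-< U x∉U x<y) = cong pred (rank-∷-> y x<y)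

    admits-toRanks : ∀ σ → StoresRead U σ → admits σ x ≡ rankAdmits (toRanks U σ) (rank x U)
    admits-toRanks start         _          = refl
    admits-toRanks (at p d v ok) (p∈U , _) rewrite <ᵇ-rank p p∈U = refl

    step-toRanks : ∀ σ → StoresRead U σ → toRanks (x ∷ U) (step σ x) ≡ rankStep (toRanks U σ) (rank x U)
    step-toRanks start _ rewrite rank-∷-≤ x ≤-refl = refl
    step-toRanks (at p d v ok) (p∈U , v∈U) rewrite <ᵇ-rank p p∈U with d ∧ (rank p U ≤ᵇ rank x U) in valley
    ... | true rewrite rank-∷-≤ x ≤-refl | rank-∷-read p p∈U
                     | <ᵇ-false {rank x U} {rank p U} (≤ᵇ-true⇒≤ (∧-conicalʳ d _ valley)) = refl
    ... | false rewrite rank-∷-≤ x ≤-refl | rank-<ᵇ p p∈U =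
      cong₂ (at (rank x U) (rank x U <ᵇ rank p U)) (valley-toRanks v v∈U) (above-toRanks v v∈U)
      where
      valley-toRanks : ∀ v → ValleyRead U v →
                       map (λ y → rank y (x ∷ U)) v ≡ map (lowerPast (rank x U)) (map (λ y → rank y U) v)
      valley-toRanks nothing  _   = refl
      valley-toRanks (just y) y∈U = cong just (rank-∷-read y y∈U)
      above-toRanks : ∀ v → ValleyRead U v → above v x ≡ aboveRank (map (λ y → rank y U) v) (rank x U)
      above-toRanks nothing  _   = refl
      above-toRanks (just y) y∈U = <ᵇ-rank y y∈U

    storesRead-step : ∀ σ → StoresRead U σ → StoresRead (x ∷ U) (step σ x)
    storesRead-step start _ rewrite ≡ᵇ-refl x = refl , tt
    storesRead-step (at p d v ok) (p∈U , v∈U) with d ∧ (p <ᵇ x)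
    ... | true  rewrite ≡ᵇ-refl x | p∈U = refl , ∧-zeroʳ (not (p ≡ᵇ x))
    ... | false rewrite ≡ᵇ-refl x = refl , valleyRead-∷ v v∈U
      where
      valleyRead-∷ : ∀ v → ValleyRead U v → ValleyRead (x ∷ U) v
      valleyRead-∷ nothing  _   = tt
      valleyRead-∷ (just y) y∈U rewrite y∈U = ∧-zeroʳ (not (y ≡ᵇ x))

  accepted≡completions : ∀ l k U σ → StoresRead U σ → rank k U ≡ l →
                         accepted l k U σ ≡ completions l (toRanks U σ)
  accepted≡completions zero    k U σ _  _      = refl
  accepted≡completions (suc l) k U σ rd rank≡l =
    trans (accepted-suc l k U σ)
      (trans (sumℕ-cong< k next) (trans (sumℕ-rank U k G) (cong (λ n → sumℕ n G) rank≡l)))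
    where
    G : ℕ → ℕ
    G r = if rankAdmits (toRanks U σ) r then completions l (rankStep (toRanks U σ) r) else 0
    next : ∀ x → x < k → (if notElemᵇ x U ∧ admits σ x then accepted l k (x ∷ U) (step σ x) else 0)
                       ≡ (if notElemᵇ x U then G (rank x U) else 0)
    next x x<k with notElemᵇ x U in x∉U
    ... | false = refl
    ... | true rewrite admits-toRanks {x} {U} x∉U σ rd
                     | accepted≡completions l k (x ∷ U) (step σ x) (storesRead-step {x} {U} x∉U σ rd)
                         (suc-injective (trans (rank-∷-> {x} {U} x∉U k x<k) rank≡l))
                     | step-toRanks {x} {U} x∉U σ rd = refl

  inc≡completions : ∀ n → inc n ≡ completions n start
  inc≡completions n = trans (inc≡accepted n) (accepted≡completions n n [] start tt (rank-[] n))

module Antidiagonal where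

  open import Data.Nat
  open import Data.Nat.Properties
  open import Data.Nat.Solver using (module +-*-Solver)
  open +-*-Solver using (solve; _:+_; _:*_; _:=_; con)
  open import Relation.Binary.PropositionalEquality
  open ≡-Reasoning
  open Binomial

  antidiag : ℕ → (ℕ → ℕ → ℕ) → ℕ
  antidiag zero h = h 0 0
  antidiag (suc j) h = h 0 (suc j) + antidiag j (λ c e → h (suc c) e)

  antidiag-cong : ∀ j {h g : ℕ → ℕ → ℕ} → (∀ c e → h c e ≡ g c e) → antidiag j h ≡ antidiag j g
  antidiag-cong zero eq = eq 0 0
  antidiag-cong (suc j) eq = cong₂ _+_ (eq 0 (suc j)) (antidiag-cong j (λ c e → eq (suc c) e))

  antidiag-+ : ∀ j (h g : ℕ → ℕ → ℕ) → antidiag j (λ c e → h c e + g c e) ≡ antidiag j h + antidiag j g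
  antidiag-+ zero h g = refl
  antidiag-+ (suc j) h g rewrite antidiag-+ j (λ c e → h (suc c) e) (λ c e → g (suc c) e) =
    solve 4 (λ a b c d → (a :+ b) :+ (c :+ d) := (a :+ c) :+ (b :+ d)) refl (h 0 (suc j)) (g 0 (suc j)) _ _

  antidiag-*ˡ : ∀ j k (h : ℕ → ℕ → ℕ) → antidiag j (λ c e → k * h c e) ≡ k * antidiag j h
  antidiag-*ˡ zero k h = refl
  antidiag-*ˡ (suc j) k h rewrite antidiag-*ˡ j k (λ c e → h (suc c) e) = sym (*-distribˡ-+ k _ _)

  antidiag-zero : ∀ j → antidiag j (λ c e → 0) ≡ 0
  antidiag-zero zero = refl
  antidiag-zero (suc j) = antidiag-zero j

  antidiag-last : ∀ j (h : ℕ → ℕ → ℕ) → antidiag (suc j) h ≡ h (suc j) 0 + antidiag j (λ c e → h c (suc e))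
  antidiag-last zero h = +-comm (h 0 1) (h 1 0)
  antidiag-last (suc j) h rewrite antidiag-last j (λ c e → h (suc c) e) =
    solve 3 (λ a b c → a :+ (b :+ c) := b :+ (a :+ c)) refl (h 0 (suc (suc j))) (h (suc (suc j)) 0) _

  mixedBinom : ℕ → ℕ → ℕ → ℕ
  mixedBinom r N j = antidiag j (λ c e → binom r c * binom N (suc e) * 2 ^ e)

  mixedBinom-r-N-0 : ∀ r N → mixedBinom r N 0 ≡ N
  mixedBinom-r-N-0 r N rewrite binom-zero r | binom-one N = trans (*-identityʳ _) (+-identityʳ N)

  mixedBinom-r-0-j : ∀ r j → mixedBinom r 0 j ≡ 0
  mixedBinom-r-0-j r j =
    trans (antidiag-cong j (λ c e → cong (λ z → z * 2 ^ e) (*-zeroʳ (binom r c)))) (antidiag-zero j)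

  mixedBinom-0-N-j : ∀ N j → mixedBinom 0 N j ≡ binom N (suc j) * 2 ^ j
  mixedBinom-0-N-j N zero = cong (_* 1) (+-identityʳ (binom N 1))
  mixedBinom-0-N-j N (suc j) = trans (cong₂ _+_ (cong (_* 2 ^ suc j) (+-identityʳ (binom N (suc (suc j)))))
                                        (antidiag-cong j (λ c e → refl)))
                             (trans (cong (binom N (suc (suc j)) * 2 ^ suc j +_) (antidiag-zero j)) (+-identityʳ _))

  mixedBinom-suc : ∀ r N j →
    mixedBinom r (suc N) (suc j) ≡ binom r (suc j) + mixedBinom r N j + mixedBinom (suc r) N (suc j)
  mixedBinom-suc r N j = begin
    mixedBinom r (suc N) (suc j)
      ≡⟨ antidiag-cong (suc j) (λ c e → trans (cong (_* 2 ^ e) (*-distribˡ-+ (binom r c) (binom N e) (binom N (suc e))))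
                                          (*-distribʳ-+ (2 ^ e) (binom r c * binom N e) _)) ⟩
    antidiag (suc j) (λ c e → binom r c * binom N e * 2 ^ e + binom r c * binom N (suc e) * 2 ^ e)
      ≡⟨ antidiag-+ (suc j) B A ⟩
    antidiag (suc j) B + antidiag (suc j) A
      ≡⟨ cong (_+ antidiag (suc j) A) (antidiag-last j B) ⟩
    (B (suc j) 0 + antidiag j (λ c e → B c (suc e))) + antidiag (suc j) A
      ≡⟨ cong₂ (λ x y → (x + y) + antidiag (suc j) A) cornerB shiftedB ⟩
    (binom r (suc j) + (P + P)) + antidiag (suc j) A
      ≡⟨ solve 3 (λ b p a → (b :+ (p :+ p)) :+ a := (b :+ p) :+ (a :+ p)) refl (binom r (suc j)) P (antidiag (suc j) A) ⟩
    binom r (suc j) + P + (antidiag (suc j) A + P)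
      ≡⟨ cong (binom r (suc j) + P +_) (sym pascalInR) ⟩
    binom r (suc j) + mixedBinom r N j + mixedBinom (suc r) N (suc j) ∎
    where
    A B : ℕ → ℕ → ℕ
    A c e = binom r c * binom N (suc e) * 2 ^ e
    B c e = binom r c * binom N e * 2 ^ e
    P = mixedBinom r N j
    cornerB : B (suc j) 0 ≡ binom r (suc j)
    cornerB rewrite binom-zero N = trans (*-identityʳ _) (*-identityʳ _)
    shiftedB : antidiag j (λ c e → B c (suc e)) ≡ P + P
    shiftedB = begin
      antidiag j (λ c e → B c (suc e))
        ≡⟨ antidiag-cong j (λ c e → solve 3 (λ x y z → x :* y :* (con 2 :* z) := con 2 :* (x :* y :* z))
                                             refl (binom r c) (binom N (suc e)) (2 ^ e)) ⟩
      antidiag j (λ c e → 2 * A c e) ≡⟨ antidiag-*ˡ j 2 A ⟩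
      2 * P ≡⟨ cong (P +_) (+-identityʳ P) ⟩
      P + P ∎
    pascalInR : mixedBinom (suc r) N (suc j) ≡ antidiag (suc j) A + P
    pascalInR = begin
      mixedBinom (suc r) N (suc j) ≡⟨⟩
      1 * binom N (suc (suc j)) * 2 ^ suc j + antidiag j (λ c e → (binom r c + binom r (suc c)) * binom N (suc e) * 2 ^ e)
        ≡⟨ cong (1 * binom N (suc (suc j)) * 2 ^ suc j +_)
             (trans (antidiag-cong j (λ c e → trans (cong (_* 2 ^ e) (*-distribʳ-+ (binom N (suc e)) (binom r c) _))
                                                (*-distribʳ-+ (2 ^ e) (binom r c * binom N (suc e)) _)))
                    (antidiag-+ j (λ c e → A c e) (λ c e → A (suc c) e))) ⟩
      1 * binom N (suc (suc j)) * 2 ^ suc j + (P + antidiag j (λ c e → A (suc c) e))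
        ≡⟨ cong (λ z → z * binom N (suc (suc j)) * 2 ^ suc j + (P + antidiag j (λ c e → A (suc c) e))) (sym (binom-zero r)) ⟩
      A 0 (suc j) + (P + antidiag j (λ c e → A (suc c) e))
        ≡⟨ solve 3 (λ a p b → a :+ (p :+ b) := (a :+ b) :+ p) refl (A 0 (suc j)) P _ ⟩
      antidiag (suc j) A + P ∎

module RankRecurrence where

  open import Data.Nat
  open import Data.Nat.Properties
  open import Data.Nat.Solver using (module +-*-Solver)
  open +-*-Solver using (solve; _:+_; _:*_; _:=_; con)
  open import Data.Bool using (Bool; true; false; _∧_; if_then_else_)
  open import Data.Maybe using (just; nothing)
  open import Data.Unit using (tt)
  open import Relation.Binary.PropositionalEquality
  open ≡-Reasoning
  open NatSum
  open Binomial
  open BoolReflect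
  open ValleyScan using (Scan; start; at)
  open RankScan
  open Antidiagonal

  total : ℕ → ℕ
  total k = completions k start

  rising : ℕ → Scan
  rising r = at r false nothing true

  falling : ℕ → Scan
  falling r = at r true nothing true

  total-suc-suc : ∀ n → total (suc (suc n)) ≡ 2 * total (suc n) + sumℕ (suc n) (λ s → innerMin n (rising s))
  total-suc-suc n = begin
    total (suc (suc n))
      ≡⟨ sumℕ-suc (suc n) _ ⟩
    total (suc n) + sumℕ (suc n) (λ s → completions (suc n) (shift (rising s)))
      ≡⟨ cong (total (suc n) +_) (trans (sumℕ-cong (suc n) (λ s → completions-shift n (rising s) tt))
                                        (sumℕ-+ (suc n) _ _)) ⟩
    total (suc n) + (total (suc n) + S)
      ≡⟨ solve 2 (λ t S → t :+ (t :+ S) := con 2 :* t :+ S) refl (total (suc n)) S ⟩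
    2 * total (suc n) + S ∎
    where S = sumℕ (suc n) (λ s → innerMin n (rising s))

  if-const-0 : ∀ (c : Bool) → (if c then 0 else 0) ≡ 0
  if-const-0 true = refl
  if-const-0 false = refl

  innerMin-afterValley : ∀ m p d k ok → innerMin m (at p d (just k) ok) ≡ 0
  innerMin-afterValley zero p d k ok = refl
  innerMin-afterValley (suc m) p d k ok = trans (sumℕ-cong (suc m) pt) (sumℕ-zero (suc m))
    where
    pt : ∀ s → (if rankAdmits (at p d (just k) ok) s then innerMin m (rankStep (at p d (just k) ok) s) else 0) ≡ 0
    pt s with d ∧ (p ≤ᵇ s)
    ... | true rewrite innerMin-afterValley m s false p true = if-const-0 ok
    ... | false = innerMin-afterValley m s (s <ᵇ p) (lowerPast s k) (k ≤ᵇ s)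

  -- From falling r or rising r, a letter of rank s < r continues downwards; a letter of rank ≥ r
  -- goes up, which from falling r makes a valley, after which the least letter can no longer be
  -- placed.
  innerMin-falling : ∀ m r → r ≤ suc m →
    innerMin (suc m) (falling r) ≡ total (suc m) + sumℕ r (λ s → innerMin m (falling s))
  innerMin-falling m r r≤ = begin
    innerMin (suc m) (falling r)
      ≡⟨ cong₂ _+_ (*-identityˡ (total (suc m))) (sumℕ-split r≤ next) ⟩
    total (suc m) + (sumℕ r next + sumℕ (suc m ∸ r) (λ t → next (r + t)))
      ≡⟨ cong (total (suc m) +_) (cong₂ _+_ (sumℕ-cong< r descent)
              (trans (sumℕ-cong (suc m ∸ r) valley) (sumℕ-zero (suc m ∸ r)))) ⟩
    total (suc m) + (sumℕ r (λ s → innerMin m (falling s)) + 0)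
      ≡⟨ cong (total (suc m) +_) (+-identityʳ _) ⟩
    total (suc m) + sumℕ r (λ s → innerMin m (falling s)) ∎
    where
    next : ℕ → ℕ
    next s = if rankAdmits (falling r) s then innerMin m (rankStep (falling r) s) else 0
    descent : ∀ s → s < r → next s ≡ innerMin m (falling s)
    descent s s<r rewrite ≤ᵇ-false s<r | <ᵇ-true s<r = refl
    valley : ∀ t → next (r + t) ≡ 0
    valley t rewrite ≤ᵇ-true (m≤m+n r t) = innerMin-afterValley m (r + t) false r true

  innerMin-rising : ∀ m r → r ≤ suc m →
    innerMin (suc m) (rising r) ≡
    total (suc m) + (sumℕ r (λ s → innerMin m (falling s)) + sumℕ (suc m ∸ r) (λ t → innerMin m (rising (r + t))))
  innerMin-rising m r r≤ = cong₂ _+_ (*-identityˡ (total (suc m)))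
    (trans (sumℕ-split r≤ _) (cong₂ _+_ (sumℕ-cong< r descent) (sumℕ-cong (suc m ∸ r) ascent)))
    where
    descent : ∀ s → s < r → innerMin m (at s (s <ᵇ r) nothing true) ≡ innerMin m (falling s)
    descent s s<r rewrite <ᵇ-true s<r = refl
    ascent : ∀ t → innerMin m (at (r + t) (r + t <ᵇ r) nothing true) ≡ innerMin m (rising (r + t))
    ascent t rewrite <ᵇ-false {r + t} {r} (m≤m+n r t) = refl

  mutual
    sum-innerMin-falling : ∀ m r → r ≤ suc m →
      sumℕ r (λ s → innerMin m (falling s)) ≡ sumℕ m (λ j → binom r (suc j) * total (m ∸ j))
    sum-innerMin-falling m r r≤ = begin
      sumℕ r (λ s → innerMin m (falling s))
        ≡⟨ sumℕ-cong< r (λ s s<r → innerMin-falling-closed m s (≤-pred (≤-trans s<r r≤))) ⟩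
      sumℕ r (λ s → sumℕ m (λ j → binom s j * total (m ∸ j)))
        ≡⟨ sumℕ-swap r m _ ⟩
      sumℕ m (λ j → sumℕ r (λ s → binom s j * total (m ∸ j)))
        ≡⟨ sumℕ-cong m (λ j → trans (sumℕ-*ʳ r (λ s → binom s j) (total (m ∸ j)))
                                    (cong (_* total (m ∸ j)) (sumℕ-binom r j))) ⟩
      sumℕ m (λ j → binom r (suc j) * total (m ∸ j)) ∎

    innerMin-falling-closed : ∀ m r → r ≤ m → innerMin m (falling r) ≡ sumℕ m (λ j → binom r j * total (m ∸ j))
    innerMin-falling-closed zero    r r≤ = refl
    innerMin-falling-closed (suc m) r r≤ = begin
      innerMin (suc m) (falling r)
        ≡⟨ innerMin-falling m r r≤ ⟩
      total (suc m) + sumℕ r (λ s → innerMin m (falling s))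
        ≡⟨ cong₂ _+_ (sym (trans (cong (_* total (suc m)) (binom-zero r)) (+-identityʳ _)))
                     (sum-innerMin-falling m r r≤) ⟩
      binom r 0 * total (suc m) + sumℕ m (λ j → binom r (suc j) * total (m ∸ j))
        ≡⟨ sym (sumℕ-suc m _) ⟩
      sumℕ (suc m) (λ j → binom r j * total (suc m ∸ j)) ∎

  sumℕ-mixedBinom-suc : ∀ m r K (g : ℕ → ℕ) →
    sumℕ m (λ j → mixedBinom r (suc K) (suc j) * g j)
    ≡ sumℕ m (λ j → binom r (suc j) * g j) + sumℕ m (λ j → mixedBinom r K j * g j)
      + sumℕ m (λ j → mixedBinom (suc r) K (suc j) * g j)
  sumℕ-mixedBinom-suc m r K g = begin
    sumℕ m (λ j → mixedBinom r (suc K) (suc j) * g j)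
      ≡⟨ sumℕ-cong m (λ j → trans (cong (_* g j) (mixedBinom-suc r K j))
           (solve 4 (λ a b c x → (a :+ b :+ c) :* x := a :* x :+ b :* x :+ c :* x) refl
              (binom r (suc j)) (mixedBinom r K j) (mixedBinom (suc r) K (suc j)) (g j))) ⟩
    sumℕ m (λ j → binom r (suc j) * g j + mixedBinom r K j * g j + mixedBinom (suc r) K (suc j) * g j)
      ≡⟨ trans (sumℕ-+ m _ _) (cong (_+ sumℕ m (λ j → mixedBinom (suc r) K (suc j) * g j)) (sumℕ-+ m _ _)) ⟩
    sumℕ m (λ j → binom r (suc j) * g j) + sumℕ m (λ j → mixedBinom r K j * g j)
      + sumℕ m (λ j → mixedBinom (suc r) K (suc j) * g j) ∎

  sum-innerMin-rising : ∀ m r K → r + K ≡ suc m →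
    sumℕ K (λ t → innerMin m (rising (r + t))) ≡ sumℕ m (λ j → mixedBinom r K j * total (m ∸ j))
  sum-innerMin-rising zero    r K       _ = sumℕ-zero K
  sum-innerMin-rising (suc m) r zero    _ =
    sym (trans (sumℕ-cong (suc m) (λ j → cong (_* total (suc m ∸ j)) (mixedBinom-r-0-j r j))) (sumℕ-zero (suc m)))
  sum-innerMin-rising (suc m) r (suc K) r+K≡ = begin
    sumℕ (suc K) (λ t → innerMin (suc m) (rising (r + t)))
      ≡⟨ sumℕ-suc K _ ⟩
    innerMin (suc m) (rising (r + 0)) + sumℕ K (λ t → innerMin (suc m) (rising (r + suc t)))
      ≡⟨ cong₂ _+_ (cong (λ z → innerMin (suc m) (rising z)) (+-identityʳ r))
                   (sumℕ-cong K (λ t → cong (λ z → innerMin (suc m) (rising z)) (+-suc r t))) ⟩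
    innerMin (suc m) (rising r) + sumℕ K (λ t → innerMin (suc m) (rising (suc r + t)))
      ≡⟨ cong₂ _+_ (innerMin-rising m r r≤) (sum-innerMin-rising (suc m) (suc r) K (trans (sym (+-suc r K)) r+K≡)) ⟩
    total (suc m) + (sumℕ r (λ s → innerMin m (falling s)) + sumℕ (suc m ∸ r) (λ t → innerMin m (rising (r + t))))
      + sumℕ (suc m) (λ j → mixedBinom (suc r) K j * total (suc m ∸ j))
      ≡⟨ cong₂ (λ x y → total (suc m) + (x + y) + sumℕ (suc m) (λ j → mixedBinom (suc r) K j * total (suc m ∸ j)))
               (sum-innerMin-falling m r r≤)
               (trans (cong (λ z → sumℕ z (λ t → innerMin m (rising (r + t)))) 1+m∸r≡K)
                      (sum-innerMin-rising m r K r+K≡1+m)) ⟩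
    total (suc m) + (B + P) + sumℕ (suc m) (λ j → mixedBinom (suc r) K j * total (suc m ∸ j))
      ≡⟨ cong (total (suc m) + (B + P) +_) (trans (sumℕ-suc m _)
              (cong (λ z → z * total (suc m) + Q) (mixedBinom-r-N-0 (suc r) K))) ⟩
    total (suc m) + (B + P) + (K * total (suc m) + Q)
      ≡⟨ solve 5 (λ t b p k q → t :+ (b :+ p) :+ (k :+ q) := (t :+ k) :+ ((b :+ p) :+ q)) refl
           (total (suc m)) B P (K * total (suc m)) Q ⟩
    suc K * total (suc m) + (B + P + Q)
      ≡⟨ cong₂ _+_ (cong (_* total (suc m)) (sym (mixedBinom-r-N-0 r (suc K))))
                   (sym (sumℕ-mixedBinom-suc m r K (λ j → total (m ∸ j)))) ⟩
    mixedBinom r (suc K) 0 * total (suc m) + sumℕ m (λ j → mixedBinom r (suc K) (suc j) * total (m ∸ j))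
      ≡⟨ sym (sumℕ-suc m _) ⟩
    sumℕ (suc m) (λ j → mixedBinom r (suc K) j * total (suc m ∸ j)) ∎
    where
    r+K≡1+m : r + K ≡ suc m
    r+K≡1+m = suc-injective (trans (sym (+-suc r K)) r+K≡)
    r≤ : r ≤ suc m
    r≤ = subst (r ≤_) r+K≡1+m (m≤m+n r K)
    1+m∸r≡K : suc m ∸ r ≡ K
    1+m∸r≡K = trans (cong (_∸ r) (sym r+K≡1+m)) (m+n∸m≡n r K)
    B P Q : ℕ
    B = sumℕ m (λ j → binom r (suc j) * total (m ∸ j))
    P = sumℕ m (λ j → mixedBinom r K j * total (m ∸ j))
    Q = sumℕ m (λ j → mixedBinom (suc r) K (suc j) * total (m ∸ j))

  total-recurrence : ∀ n →
    total (suc (suc n)) ≡ 2 * total (suc n) + sumℕ n (λ j → binom (suc n) (suc j) * 2 ^ j * total (n ∸ j))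
  total-recurrence n = begin
    total (suc (suc n))
      ≡⟨ total-suc-suc n ⟩
    2 * total (suc n) + sumℕ (suc n) (λ s → innerMin n (rising s))
      ≡⟨ cong (2 * total (suc n) +_) (sum-innerMin-rising n 0 (suc n) refl) ⟩
    2 * total (suc n) + sumℕ n (λ j → mixedBinom 0 (suc n) j * total (n ∸ j))
      ≡⟨ cong (2 * total (suc n) +_) (sumℕ-cong n (λ j → cong (_* total (n ∸ j)) (mixedBinom-0-N-j (suc n) j))) ⟩
    2 * total (suc n) + sumℕ n (λ j → binom (suc n) (suc j) * 2 ^ j * total (n ∸ j)) ∎

module NatCast where

  open import Data.Nat as ℕ using (ℕ; zero; suc; _!)
  open import Data.Nat.Properties as ℕP using (_!≢0; _!*_!≢0)
  open import Data.Nat.DivMod using (m/n*n≡m)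
  open import Data.Nat.Combinatorics using (nCk≡n!/k![n-k]!; k![n∸k]!∣n!)
  open import Data.Integer as ℤ using (+_)
  import Data.Integer.Properties as ℤP
  import Data.Integer.Solver as ℤSolver
  open import Data.Rational
  open import Data.Rational.Properties
  open import Data.Rational.Unnormalised as U using (mkℚᵘ; *≡*) renaming (_≃_ to _≃ᵘ_)
  import Data.Rational.Unnormalised.Properties as UP
  open import Data.Rational.Solver using (module +-*-Solver)
  open +-*-Solver using (solve; _:*_; _:=_; con)
  open import Relation.Binary.PropositionalEquality
  open ≡-Reasoning
  open Binomial

  ι : ℕ → ℚ
  ι n = (+ n) / 1

  recip : (m : ℕ) → .{{ℕ.NonZero m}} → ℚ
  recip m = (+ 1) / m

  private
    module Z = ℤSolver.+-*-Solver

    toℚᵘ-/ : ∀ a b → toℚᵘ ((+ a) / suc b) ≃ᵘ mkℚᵘ (+ a) b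
    toℚᵘ-/ a b = toℚᵘ-fromℚᵘ (mkℚᵘ (+ a) b)

  ι-+ : ∀ a b → ι (a ℕ.+ b) ≡ ι a + ι b
  ι-+ a b = toℚᵘ-injective (UP.≃-trans (toℚᵘ-/ (a ℕ.+ b) 0) (UP.≃-trans numerators
              (UP.≃-sym (UP.≃-trans (toℚᵘ-homo-+ (ι a) (ι b)) (UP.+-cong (toℚᵘ-/ a 0) (toℚᵘ-/ b 0))))))
    where
    numerators : mkℚᵘ (+ (a ℕ.+ b)) 0 ≃ᵘ (mkℚᵘ (+ a) 0 U.+ mkℚᵘ (+ b) 0)
    numerators = *≡* (trans (cong (ℤ._* + 1) (ℤP.pos-+ a b))
      (Z.solve 2 (λ x y → (x Z.:+ y) Z.:* Z.con (+ 1) Z.:= (x Z.:* Z.con (+ 1) Z.:+ y Z.:* Z.con (+ 1)) Z.:* Z.con (+ 1))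
               refl (+ a) (+ b)))

  ι-* : ∀ a b → ι (a ℕ.* b) ≡ ι a * ι b
  ι-* a b = toℚᵘ-injective (UP.≃-trans (toℚᵘ-/ (a ℕ.* b) 0) (UP.≃-trans numerators
              (UP.≃-sym (UP.≃-trans (toℚᵘ-homo-* (ι a) (ι b)) (UP.*-cong (toℚᵘ-/ a 0) (toℚᵘ-/ b 0))))))
    where
    numerators : mkℚᵘ (+ (a ℕ.* b)) 0 ≃ᵘ (mkℚᵘ (+ a) 0 U.* mkℚᵘ (+ b) 0)
    numerators = *≡* (trans (cong (ℤ._* + 1) (ℤP.pos-* a b))
      (Z.solve 2 (λ x y → (x Z.:* y) Z.:* Z.con (+ 1) Z.:= (x Z.:* y) Z.:* Z.con (+ 1)) refl (+ a) (+ b)))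

  /-≡ι*recip : ∀ a m .{{_ : ℕ.NonZero m}} → (+ a) / m ≡ ι a * recip m
  /-≡ι*recip a (suc b) = toℚᵘ-injective (UP.≃-trans (toℚᵘ-/ a b) (UP.≃-trans numerators
              (UP.≃-sym (UP.≃-trans (toℚᵘ-homo-* (ι a) (recip (suc b))) (UP.*-cong (toℚᵘ-/ a 0) (toℚᵘ-/ 1 b))))))
    where
    numerators : mkℚᵘ (+ a) b ≃ᵘ (mkℚᵘ (+ a) 0 U.* mkℚᵘ (+ 1) b)
    numerators rewrite ℕP.+-identityʳ b =
      *≡* (Z.solve 2 (λ x y → x Z.:* y Z.:= (x Z.:* Z.con (+ 1)) Z.:* y) refl (+ a) (+ suc b))

  recip-inverse : ∀ m .{{_ : ℕ.NonZero m}} → recip m * ι m ≡ 1ℚ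
  recip-inverse (suc b) = toℚᵘ-injective (UP.≃-trans (toℚᵘ-homo-* (recip (suc b)) (ι (suc b)))
              (UP.≃-trans (UP.*-cong (toℚᵘ-/ 1 b) (toℚᵘ-/ (suc b) 0)) numerators))
    where
    numerators : (mkℚᵘ (+ 1) b U.* mkℚᵘ (+ suc b) 0) ≃ᵘ mkℚᵘ (+ 1) 0
    numerators = *≡* (Z.solve 1 (λ y → (Z.con (+ 1) Z.:* y) Z.:* Z.con (+ 1) Z.:= Z.con (+ 1) Z.:* (y Z.:* Z.con (+ 1)))
                               refl (+ suc b))

  recip-* : ∀ a b .{{_ : ℕ.NonZero a}} .{{_ : ℕ.NonZero b}} → recip (a ℕ.* b) {{ℕP.m*n≢0 a b}} ≡ recip a * recip b
  recip-* a b = begin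
    x                                       ≡⟨ solve 1 (λ x → x := x :* con 1ℚ :* con 1ℚ) refl x ⟩
    x * 1ℚ * 1ℚ                             ≡⟨ cong₂ (λ u v → x * u * v) (sym (recip-inverse a)) (sym (recip-inverse b)) ⟩
    x * (recip a * ι a) * (recip b * ι b)
      ≡⟨ solve 5 (λ x p q r s → x :* (p :* q) :* (r :* s) := (x :* (q :* s)) :* (p :* r))
                 refl x (recip a) (ι a) (recip b) (ι b) ⟩
    x * (ι a * ι b) * (recip a * recip b)   ≡⟨ cong (λ z → x * z * (recip a * recip b)) (sym (ι-* a b)) ⟩
    x * ι (a ℕ.* b) * (recip a * recip b)   ≡⟨ cong (_* (recip a * recip b)) (recip-inverse (a ℕ.* b) {{ℕP.m*n≢0 a b}}) ⟩
    1ℚ * (recip a * recip b)                ≡⟨ *-identityˡ _ ⟩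
    recip a * recip b ∎
    where
    x = recip (a ℕ.* b) {{ℕP.m*n≢0 a b}}

  ι-sumℕ : ∀ n (f : ℕ → ℕ) → ι (sumℕ n f) ≡ sumℚ n (λ i → ι (f i))
  ι-sumℕ zero    f = refl
  ι-sumℕ (suc n) f = trans (ι-+ (sumℕ n f) (f n)) (cong (_+ ι (f n)) (ι-sumℕ n f))

  invFact : ℕ → ℚ
  invFact k = recip (k !) {{k !≢0}}

  invFact-suc : ∀ j → invFact (suc j) * ι (suc j) ≡ invFact j
  invFact-suc j = begin
    invFact (suc j) * ι (suc j)         ≡⟨ cong (_* ι (suc j)) (recip-* (suc j) (j !) {{_}} {{j !≢0}}) ⟩
    recip (suc j) * invFact j * ι (suc j)
      ≡⟨ solve 3 (λ a b c → a :* b :* c := (a :* c) :* b) refl (recip (suc j)) (invFact j) (ι (suc j)) ⟩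
    recip (suc j) * ι (suc j) * invFact j ≡⟨ cong (_* invFact j) (recip-inverse (suc j)) ⟩
    1ℚ * invFact j                        ≡⟨ *-identityˡ _ ⟩
    invFact j ∎

  binom-factorials : ∀ N k → k ℕ.≤ N → binom N k ℕ.* (k ! ℕ.* (N ℕ.∸ k) !) ≡ N !
  binom-factorials N k k≤N rewrite binom≡C N k | nCk≡n!/k![n-k]! k≤N =
    m/n*n≡m {{k !* (N ℕ.∸ k) !≢0}} (k![n∸k]!∣n! k≤N)

  binom-invFact : ∀ N k → k ℕ.≤ N → ι (binom N k) * invFact N ≡ invFact k * invFact (N ℕ.∸ k)
  binom-invFact N k k≤N = begin
    b * f                                 ≡⟨ solve 2 (λ b c → b :* c := b :* c :* con 1ℚ :* con 1ℚ) refl b f ⟩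
    b * f * 1ℚ * 1ℚ                       ≡⟨ cong₂ (λ u v → b * f * u * v) (sym (recip-inverse (k !) {{k !≢0}}))
                                                   (sym (recip-inverse ((N ℕ.∸ k) !) {{(N ℕ.∸ k) !≢0}})) ⟩
    b * f * (fk * ι (k !)) * (fl * ι ((N ℕ.∸ k) !))
      ≡⟨ solve 6 (λ b c p a q d → b :* c :* (p :* a) :* (q :* d) := (b :* (a :* d)) :* c :* (p :* q))
           refl b f fk (ι (k !)) fl (ι ((N ℕ.∸ k) !)) ⟩
    b * (ι (k !) * ι ((N ℕ.∸ k) !)) * f * (fk * fl)
      ≡⟨ cong (λ z → z * f * (fk * fl)) (trans (sym (trans (ι-* (binom N k) _) (cong (b *_) (ι-* (k !) _))))
                                               (cong ι (binom-factorials N k k≤N))) ⟩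
    ι (N !) * f * (fk * fl)               ≡⟨ cong (_* (fk * fl)) (trans (*-comm (ι (N !)) f) (recip-inverse (N !) {{N !≢0}})) ⟩
    1ℚ * (fk * fl)                        ≡⟨ *-identityˡ _ ⟩
    fk * fl ∎
    where
    b = ι (binom N k)
    f = invFact N
    fk = invFact k
    fl = invFact (N ℕ.∸ k)

module PowerSeries where

  open import Data.Nat as ℕ using (ℕ; zero; suc)
  import Data.Nat.Properties as ℕP
  open import Data.Sum using (inj₁; inj₂)
  open import Data.Rational
  open import Data.Rational.Properties
  open import Data.Rational.Solver using (module +-*-Solver)
  open +-*-Solver using (solve; _:+_; _:*_; _:=_)
  open import Relation.Binary.PropositionalEquality
  open ≡-Reasoning
  open NatCast

  sumℚ-cong : ∀ n {f g : ℕ → ℚ} → (∀ i → f i ≡ g i) → sumℚ n f ≡ sumℚ n g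
  sumℚ-cong zero    f≗g = refl
  sumℚ-cong (suc n) f≗g = cong₂ _+_ (sumℚ-cong n f≗g) (f≗g n)

  sumℚ-cong< : ∀ n {f g : ℕ → ℚ} → (∀ i → i ℕ.< n → f i ≡ g i) → sumℚ n f ≡ sumℚ n g
  sumℚ-cong< zero    f≗g = refl
  sumℚ-cong< (suc n) f≗g = cong₂ _+_ (sumℚ-cong< n (λ i i<n → f≗g i (ℕP.m<n⇒m<1+n i<n))) (f≗g n (ℕP.n<1+n n))

  sumℚ-zero : ∀ n → sumℚ n (λ _ → 0ℚ) ≡ 0ℚ
  sumℚ-zero zero    = refl
  sumℚ-zero (suc n) rewrite sumℚ-zero n = refl

  sumℚ-*ˡ : ∀ n c (f : ℕ → ℚ) → c * sumℚ n f ≡ sumℚ n (λ i → c * f i)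
  sumℚ-*ˡ zero    c f = *-zeroʳ c
  sumℚ-*ˡ (suc n) c f rewrite sym (sumℚ-*ˡ n c f) = *-distribˡ-+ c _ _

  sumℚ-suc : ∀ n (f : ℕ → ℚ) → sumℚ (suc n) f ≡ f 0 + sumℚ n (λ i → f (suc i))
  sumℚ-suc zero    f = trans (+-identityˡ (f 0)) (sym (+-identityʳ (f 0)))
  sumℚ-suc (suc n) f rewrite sumℚ-suc n f = +-assoc (f 0) _ _

  sumℚ-extend : ∀ d u (f : ℕ → ℚ) → (∀ j → u ℕ.< j → f j ≡ 0ℚ) →
                sumℚ (suc u) f ≡ sumℚ (suc (u ℕ.+ d)) f
  sumℚ-extend zero    u f vanish rewrite ℕP.+-identityʳ u = refl
  sumℚ-extend (suc d) u f vanish rewrite ℕP.+-suc u d | vanish (suc (u ℕ.+ d)) (ℕ.s≤s (ℕP.m≤m+n u d)) =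
    trans (sumℚ-extend d u f vanish) (sym (+-identityʳ _))

  antidiagℚ : ℕ → (ℕ → ℕ → ℚ) → ℚ
  antidiagℚ zero h = h 0 0
  antidiagℚ (suc n) h = h 0 (suc n) + antidiagℚ n (λ i j → h (suc i) j)

  sumℚ-antidiag : ∀ n (h : ℕ → ℕ → ℚ) → sumℚ (suc n) (λ k → h k (n ℕ.∸ k)) ≡ antidiagℚ n h
  sumℚ-antidiag zero h = +-identityˡ (h 0 0)
  sumℚ-antidiag (suc n) h = trans (sumℚ-suc (suc n) _) (cong (h 0 (suc n) +_) (sumℚ-antidiag n (λ i j → h (suc i) j)))

  ⊛-antidiag : ∀ A B n → (A ⊛ B) n ≡ antidiagℚ n (λ i j → A i * B j)
  ⊛-antidiag A B n = sumℚ-antidiag n (λ i j → A i * B j)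

  antidiagℚ-cong : ∀ n {h g : ℕ → ℕ → ℚ} → (∀ i j → i ℕ.+ j ≡ n → h i j ≡ g i j) →
                   antidiagℚ n h ≡ antidiagℚ n g
  antidiagℚ-cong zero eq = eq 0 0 refl
  antidiagℚ-cong (suc n) eq = cong₂ _+_ (eq 0 (suc n) refl) (antidiagℚ-cong n (λ i j e → eq (suc i) j (cong suc e)))

  antidiagℚ-+ : ∀ n (h g : ℕ → ℕ → ℚ) →
                antidiagℚ n (λ i j → h i j + g i j) ≡ antidiagℚ n h + antidiagℚ n g
  antidiagℚ-+ zero h g = refl
  antidiagℚ-+ (suc n) h g rewrite antidiagℚ-+ n (λ i j → h (suc i) j) (λ i j → g (suc i) j) =
    solve 4 (λ a b c d → (a :+ b) :+ (c :+ d) := (a :+ c) :+ (b :+ d)) refl (h 0 (suc n)) (g 0 (suc n)) _ _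

  antidiagℚ-*ˡ : ∀ n c (h : ℕ → ℕ → ℚ) → antidiagℚ n (λ i j → c * h i j) ≡ c * antidiagℚ n h
  antidiagℚ-*ˡ zero c h = refl
  antidiagℚ-*ˡ (suc n) c h rewrite antidiagℚ-*ˡ n c (λ i j → h (suc i) j) = sym (*-distribˡ-+ c _ _)

  antidiagℚ-*ʳ : ∀ n c (h : ℕ → ℕ → ℚ) → antidiagℚ n (λ i j → h i j * c) ≡ antidiagℚ n h * c
  antidiagℚ-*ʳ n c h = trans (antidiagℚ-cong n (λ i j _ → *-comm (h i j) c)) (trans (antidiagℚ-*ˡ n c h) (*-comm c _))

  antidiagℚ-0 : ∀ n → antidiagℚ n (λ _ _ → 0ℚ) ≡ 0ℚ
  antidiagℚ-0 zero = refl
  antidiagℚ-0 (suc n) rewrite antidiagℚ-0 n = refl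

  antidiagℚ-last : ∀ n (h : ℕ → ℕ → ℚ) →
                   antidiagℚ (suc n) h ≡ h (suc n) 0 + antidiagℚ n (λ i j → h i (suc j))
  antidiagℚ-last zero h = +-comm (h 0 1) (h 1 0)
  antidiagℚ-last (suc n) h rewrite antidiagℚ-last n (λ i j → h (suc i) j) =
    solve 3 (λ a b c → a :+ (b :+ c) := b :+ (a :+ c)) refl (h 0 (suc (suc n))) (h (suc (suc n)) 0) _

  antidiagℚ-comm : ∀ n (h : ℕ → ℕ → ℚ) → antidiagℚ n h ≡ antidiagℚ n (λ i j → h j i)
  antidiagℚ-comm zero h = refl
  antidiagℚ-comm (suc n) h = trans (antidiagℚ-last n h) (cong (h (suc n) 0 +_) (antidiagℚ-comm n (λ i j → h i (suc j))))

  antidiagℚ-assoc : ∀ n (h : ℕ → ℕ → ℕ → ℚ) →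
    antidiagℚ n (λ i j → antidiagℚ i (λ a b → h a b j)) ≡ antidiagℚ n (λ a m → antidiagℚ m (λ b j → h a b j))
  antidiagℚ-assoc zero h = refl
  antidiagℚ-assoc (suc n) h = begin
    h 0 0 (suc n) + antidiagℚ n (λ i j → h 0 (suc i) j + antidiagℚ i (λ a b → h (suc a) b j))
      ≡⟨ cong (h 0 0 (suc n) +_) (antidiagℚ-+ n (λ i j → h 0 (suc i) j) (λ i j → antidiagℚ i (λ a b → h (suc a) b j))) ⟩
    h 0 0 (suc n) + (antidiagℚ n (λ i j → h 0 (suc i) j) + antidiagℚ n (λ i j → antidiagℚ i (λ a b → h (suc a) b j)))
      ≡⟨ cong (λ z → h 0 0 (suc n) + (antidiagℚ n (λ i j → h 0 (suc i) j) + z))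
              (antidiagℚ-assoc n (λ a b j → h (suc a) b j)) ⟩
    h 0 0 (suc n) + (antidiagℚ n (λ i j → h 0 (suc i) j) + antidiagℚ n (λ a m → antidiagℚ m (λ b j → h (suc a) b j)))
      ≡⟨ sym (+-assoc (h 0 0 (suc n)) _ _) ⟩
    h 0 0 (suc n) + antidiagℚ n (λ i j → h 0 (suc i) j) + antidiagℚ n (λ a m → antidiagℚ m (λ b j → h (suc a) b j)) ∎

  antidiagℚ-weight : ∀ n (h : ℕ → ℕ → ℚ) →
                     ι n * antidiagℚ n h ≡ antidiagℚ n (λ i j → (ι i + ι j) * h i j)
  antidiagℚ-weight zero h = trans (*-zeroˡ (h 0 0)) (sym (trans (cong (_* h 0 0) (+-identityˡ 0ℚ)) (*-zeroˡ (h 0 0))))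
  antidiagℚ-weight (suc n) h = begin
    ι (suc n) * (h 0 (suc n) + antidiagℚ n h')
      ≡⟨ *-distribˡ-+ (ι (suc n)) _ _ ⟩
    ι (suc n) * h 0 (suc n) + ι (suc n) * antidiagℚ n h'
      ≡⟨ cong₂ _+_ (cong (_* h 0 (suc n)) (sym (+-identityˡ (ι (suc n))))) (cong (_* antidiagℚ n h') (ι-+ 1 n)) ⟩
    (ι 0 + ι (suc n)) * h 0 (suc n) + (ι 1 + ι n) * antidiagℚ n h'
      ≡⟨ cong ((ι 0 + ι (suc n)) * h 0 (suc n) +_) (trans (*-distribʳ-+ (antidiagℚ n h') (ι 1) (ι n))
            (trans (cong₂ _+_ (sym (antidiagℚ-*ˡ n (ι 1) h')) (antidiagℚ-weight n h')) (sym (antidiagℚ-+ n _ _)))) ⟩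
    (ι 0 + ι (suc n)) * h 0 (suc n) + antidiagℚ n (λ i j → ι 1 * h' i j + (ι i + ι j) * h' i j)
      ≡⟨ cong ((ι 0 + ι (suc n)) * h 0 (suc n) +_) (antidiagℚ-cong n (λ i j _ →
            trans (sym (*-distribʳ-+ (h' i j) (ι 1) (ι i + ι j)))
                  (cong (_* h' i j) (trans (sym (+-assoc (ι 1) (ι i) (ι j))) (cong (_+ ι j) (sym (ι-+ 1 i))))))) ⟩
    (ι 0 + ι (suc n)) * h 0 (suc n) + antidiagℚ n (λ i j → (ι (suc i) + ι j) * h' i j) ∎
    where
    h' : ℕ → ℕ → ℚ
    h' i j = h (suc i) j

  ⊛-comm : ∀ A B → (A ⊛ B) ≗ (B ⊛ A)
  ⊛-comm A B n = trans (⊛-antidiag A B n) (trans (antidiagℚ-comm n _)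
    (trans (antidiagℚ-cong n (λ i j _ → *-comm (A j) (B i))) (sym (⊛-antidiag B A n))))

  ⊛-assoc : ∀ A B C → ((A ⊛ B) ⊛ C) ≗ (A ⊛ (B ⊛ C))
  ⊛-assoc A B C n = begin
    ((A ⊛ B) ⊛ C) n ≡⟨ ⊛-antidiag (A ⊛ B) C n ⟩
    antidiagℚ n (λ i j → (A ⊛ B) i * C j)
      ≡⟨ antidiagℚ-cong n (λ i j _ → trans (cong (_* C j) (⊛-antidiag A B i)) (sym (antidiagℚ-*ʳ i (C j) _))) ⟩
    antidiagℚ n (λ i j → antidiagℚ i (λ a b → A a * B b * C j)) ≡⟨ antidiagℚ-assoc n (λ a b j → A a * B b * C j) ⟩
    antidiagℚ n (λ a m → antidiagℚ m (λ b j → A a * B b * C j))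
      ≡⟨ antidiagℚ-cong n (λ a m _ → trans (antidiagℚ-cong m (λ b j _ → *-assoc (A a) (B b) (C j)))
            (trans (antidiagℚ-*ˡ m (A a) _) (cong (A a *_) (sym (⊛-antidiag B C m))))) ⟩
    antidiagℚ n (λ a m → A a * (B ⊛ C) m) ≡⟨ sym (⊛-antidiag A (B ⊛ C) n) ⟩
    (A ⊛ (B ⊛ C)) n ∎

  ⊛-cong : ∀ {A A′ B B′} → A ≗ A′ → B ≗ B′ → (A ⊛ B) ≗ (A′ ⊛ B′)
  ⊛-cong {A} {A′} {B} {B′} A≗A′ B≗B′ n = trans (⊛-antidiag A B n)
    (trans (antidiagℚ-cong n (λ i j _ → cong₂ _*_ (A≗A′ i) (B≗B′ j))) (sym (⊛-antidiag A′ B′ n)))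

  ⊛-congˡ : ∀ {A A′} B → A ≗ A′ → (A ⊛ B) ≗ (A′ ⊛ B)
  ⊛-congˡ {A} {A′} B A≗A′ = ⊛-cong {A} {A′} {B} {B} A≗A′ (λ _ → refl)

  ⊛-congʳ : ∀ A {B B′} → B ≗ B′ → (A ⊛ B) ≗ (A ⊛ B′)
  ⊛-congʳ A {B} {B′} B≗B′ = ⊛-cong {A} {A} {B} {B′} (λ _ → refl) B≗B′

  ⊛-⊕ʳ : ∀ A B C → (A ⊛ (B ⊕ C)) ≗ ((A ⊛ B) ⊕ (A ⊛ C))
  ⊛-⊕ʳ A B C n = trans (⊛-antidiag A (B ⊕ C) n) (trans (antidiagℚ-cong n (λ i j _ → *-distribˡ-+ (A i) (B j) (C j)))
                 (trans (antidiagℚ-+ n _ _) (sym (cong₂ _+_ (⊛-antidiag A B n) (⊛-antidiag A C n)))))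

  ⊛-⊕ˡ : ∀ A B C → ((A ⊕ B) ⊛ C) ≗ ((A ⊛ C) ⊕ (B ⊛ C))
  ⊛-⊕ˡ A B C n = trans (⊛-comm (A ⊕ B) C n) (trans (⊛-⊕ʳ C A B n) (cong₂ _+_ (⊛-comm C A n) (⊛-comm C B n)))

  ⊛-scaleʳ : ∀ c A B → (A ⊛ scale c B) ≗ scale c (A ⊛ B)
  ⊛-scaleʳ c A B n = trans (⊛-antidiag A (scale c B) n)
    (trans (antidiagℚ-cong n (λ i j _ → solve 3 (λ x y z → x :* (y :* z) := y :* (x :* z)) refl (A i) c (B j)))
           (trans (antidiagℚ-*ˡ n c _) (cong (c *_) (sym (⊛-antidiag A B n)))))

  ⊛-unitˡ : ∀ A → (const 1ℚ ⊛ A) ≗ A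
  ⊛-unitˡ A zero = trans (+-identityˡ _) (*-identityˡ (A 0))
  ⊛-unitˡ A (suc n) = trans (⊛-antidiag (const 1ℚ) A (suc n)) (trans (cong₂ _+_ (*-identityˡ (A (suc n)))
     (trans (antidiagℚ-cong n (λ i j _ → *-zeroˡ (A j))) (antidiagℚ-0 n))) (+-identityʳ _))

  D : Series → Series
  D A n = ι (suc n) * A (suc n)

  D-⊛ : ∀ A B → D (A ⊛ B) ≗ ((D A ⊛ B) ⊕ (A ⊛ D B))
  D-⊛ A B n = begin
    ι (suc n) * (A ⊛ B) (suc n)
      ≡⟨ cong (ι (suc n) *_) (⊛-antidiag A B (suc n)) ⟩
    ι (suc n) * antidiagℚ (suc n) (λ i j → A i * B j)
      ≡⟨ antidiagℚ-weight (suc n) (λ i j → A i * B j) ⟩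
    antidiagℚ (suc n) (λ i j → (ι i + ι j) * (A i * B j))
      ≡⟨ antidiagℚ-cong (suc n) (λ i j _ → solve 4 (λ x y a b → (x :+ y) :* (a :* b) := (x :* a) :* b :+ a :* (y :* b))
                                                   refl (ι i) (ι j) (A i) (B j)) ⟩
    antidiagℚ (suc n) (λ i j → ι i * A i * B j + A i * (ι j * B j))
      ≡⟨ antidiagℚ-+ (suc n) (λ i j → ι i * A i * B j) (λ i j → A i * (ι j * B j)) ⟩
    antidiagℚ (suc n) (λ i j → ι i * A i * B j) + antidiagℚ (suc n) (λ i j → A i * (ι j * B j))
      ≡⟨ cong₂ _+_ first second ⟩
    (D A ⊛ B) n + (A ⊛ D B) n ∎
    where
    first : antidiagℚ (suc n) (λ i j → ι i * A i * B j) ≡ (D A ⊛ B) n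
    first = trans (cong (_+ antidiagℚ n (λ i j → ι (suc i) * A (suc i) * B j))
                   (trans (cong (_* B (suc n)) (*-zeroˡ (A 0))) (*-zeroˡ (B (suc n)))))
            (trans (+-identityˡ _) (sym (⊛-antidiag (D A) B n)))
    second : antidiagℚ (suc n) (λ i j → A i * (ι j * B j)) ≡ (A ⊛ D B) n
    second = trans (antidiagℚ-last n (λ i j → A i * (ι j * B j)))
      (trans (cong (_+ antidiagℚ n (λ i j → A i * (ι (suc j) * B (suc j))))
                   (trans (cong (A (suc n) *_) (*-zeroˡ (B 0))) (*-zeroʳ (A (suc n)))))
             (trans (+-identityˡ _) (sym (⊛-antidiag A (D B) n))))

  antidiagℚ-sumℚ : ∀ n m (h : ℕ → ℕ → ℕ → ℚ) →
    antidiagℚ n (λ i j → sumℚ m (λ k → h k i j)) ≡ sumℚ m (λ k → antidiagℚ n (h k))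
  antidiagℚ-sumℚ n zero    h = antidiagℚ-0 n
  antidiagℚ-sumℚ n (suc m) h = trans (antidiagℚ-+ n _ _) (cong (_+ antidiagℚ n (h m)) (antidiagℚ-sumℚ n m h))

  zeroS : Series
  zeroS _ = 0ℚ

  ⊛-zeroˡ : ∀ {A} B → A ≗ zeroS → (A ⊛ B) ≗ zeroS
  ⊛-zeroˡ {A} B A≗0 n = trans (⊛-antidiag A B n)
    (trans (antidiagℚ-cong n (λ i j _ → trans (cong (_* B j) (A≗0 i)) (*-zeroˡ (B j)))) (antidiagℚ-0 n))

  ⊛-zeroʳ : ∀ A {B} → B ≗ zeroS → (A ⊛ B) ≗ zeroS
  ⊛-zeroʳ A {B} B≗0 n = trans (⊛-comm A B n) (⊛-zeroˡ A B≗0 n)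

  ⊕-cong : ∀ {A A′ B B′} → A ≗ A′ → B ≗ B′ → (A ⊕ B) ≗ (A′ ⊕ B′)
  ⊕-cong A≗A′ B≗B′ n = cong₂ _+_ (A≗A′ n) (B≗B′ n)

  D-cong : ∀ {A B} → A ≗ B → D A ≗ D B
  D-cong A≗B n = cong (ι (suc n) *_) (A≗B (suc n))

  coeff-suc : ∀ (A : Series) n → A (suc n) ≡ recip (suc n) * D A n
  coeff-suc A n = sym (trans (sym (*-assoc (recip (suc n)) (ι (suc n)) (A (suc n))))
                             (trans (cong (_* A (suc n)) (recip-inverse (suc n))) (*-identityˡ _)))

  D≡0⇒coeff≡0 : ∀ (A : Series) n → D A n ≡ 0ℚ → A (suc n) ≡ 0ℚ
  D≡0⇒coeff≡0 A n DA≡0 = trans (coeff-suc A n) (trans (cong (recip (suc n) *_) DA≡0) (*-zeroʳ (recip (suc n))))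

  -- A′ = P A + Q expresses each coefficient A (n + 1) through A 0, …, A n.
  linearODE-unique : ∀ (P Q A B : Series) → A 0 ≡ B 0 →
    D A ≗ (P ⊛ A) ⊕ Q → D B ≗ (P ⊛ B) ⊕ Q → A ≗ B
  linearODE-unique P Q A B A0≡B0 odeA odeB n = upTo n n ℕP.≤-refl
    where
    upTo : ∀ n m → m ℕ.≤ n → A m ≡ B m
    upTo zero    .zero ℕ.z≤n = A0≡B0
    upTo (suc n) m m≤1+n with ℕP.m≤n⇒m<n∨m≡n m≤1+n
    ... | inj₁ m<1+n = upTo n m (ℕP.≤-pred m<1+n)
    ... | inj₂ refl  = begin
      A (suc n)                            ≡⟨ coeff-suc A n ⟩
      recip (suc n) * D A n                ≡⟨ cong (recip (suc n) *_) (odeA n) ⟩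
      recip (suc n) * ((P ⊛ A) n + Q n)    ≡⟨ cong (λ z → recip (suc n) * (z + Q n)) P⊛A≡P⊛B ⟩
      recip (suc n) * ((P ⊛ B) n + Q n)    ≡⟨ cong (recip (suc n) *_) (sym (odeB n)) ⟩
      recip (suc n) * D B n                ≡⟨ sym (coeff-suc B n) ⟩
      B (suc n) ∎
      where
      P⊛A≡P⊛B : (P ⊛ A) n ≡ (P ⊛ B) n
      P⊛A≡P⊛B = trans (⊛-antidiag P A n) (trans (antidiagℚ-cong n (λ i j i+j≡n → cong (P i *_)
                   (upTo n j (ℕP.≤-trans (ℕP.m≤n+m j i) (ℕP.≤-reflexive i+j≡n))))) (sym (⊛-antidiag P B n)))

module SeriesExp where

  open import Data.Nat as ℕ using (ℕ; zero; suc; _^_)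
  import Data.Nat.Properties as ℕP
  open import Data.Bool using (true; false; if_then_else_)
  open import Data.Rational
  open import Data.Rational.Properties
  open import Data.Rational.Solver using (module +-*-Solver)
  open +-*-Solver using (solve; _:+_; _:*_; _:=_; con)
  open import Relation.Binary.PropositionalEquality
  open ≡-Reasoning
  open BoolReflect using (≡ᵇ-refl; ≡ᵇ-false)
  open NatCast
  open PowerSeries

  dropConst : Series → Series
  dropConst G zero    = 0ℚ
  dropConst G (suc m) = G (suc m)

  pow-cong : ∀ {A B} → A ≗ B → ∀ k → pow A k ≗ pow B k
  pow-cong A≗B zero    n = refl
  pow-cong A≗B (suc k)   = ⊛-cong A≗B (pow-cong A≗B k)

  -- expS, with the constant term dropped by a named function instead of inside a where block
  exp′ : Series → Series
  exp′ G n = sumℚ (suc n) (λ k → invFact k * pow (dropConst G) k n)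

  expS≗exp′ : ∀ G → expS G ≗ exp′ G
  expS≗exp′ G n = sumℚ-cong (suc n) (λ k → cong (invFact k *_) (pow-cong (λ { zero → refl ; (suc m) → refl }) k n))

  module _ (G : Series) where

    private
      Z = dropConst G

    pow-dropConst-low : ∀ k n → n ℕ.< k → pow Z k n ≡ 0ℚ
    pow-dropConst-low (suc k) n n<1+k = trans (⊛-antidiag Z (pow Z k) n) (trans (antidiagℚ-cong n term) (antidiagℚ-0 n))
      where
      term : ∀ i j → i ℕ.+ j ≡ n → Z i * pow Z k j ≡ 0ℚ
      term zero    j _      = *-zeroˡ (pow Z k j)
      term (suc i) j i+j≡n  = trans (cong (Z (suc i) *_) (pow-dropConst-low k j j<k)) (*-zeroʳ (G (suc i)))
        where
        j<k : j ℕ.< k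
        j<k = ℕP.≤-trans (ℕ.s≤s (ℕP.m≤n+m j i)) (ℕP.≤-trans (ℕP.≤-reflexive i+j≡n) (ℕP.≤-pred n<1+k))

    D-pow : ∀ k → D (pow Z (suc k)) ≗ scale (ι (suc k)) (D Z ⊛ pow Z k)
    D-pow zero n = begin
      D (Z ⊛ const 1ℚ) n                             ≡⟨ D-⊛ Z (const 1ℚ) n ⟩
      (D Z ⊛ const 1ℚ) n + (Z ⊛ D (const 1ℚ)) n     ≡⟨ cong ((D Z ⊛ const 1ℚ) n +_) (⊛-zeroʳ Z D1≗0 n) ⟩
      (D Z ⊛ const 1ℚ) n + 0ℚ                       ≡⟨ +-identityʳ ((D Z ⊛ const 1ℚ) n) ⟩
      (D Z ⊛ const 1ℚ) n                            ≡⟨ *-identityˡ ((D Z ⊛ const 1ℚ) n) ⟨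
      1ℚ * (D Z ⊛ const 1ℚ) n ∎
      where
      D1≗0 : D (const 1ℚ) ≗ zeroS
      D1≗0 j = *-zeroʳ (ι (suc j))
    D-pow (suc k) n = begin
      D (Z ⊛ Zᵏ⁺¹) n                                ≡⟨ D-⊛ Z Zᵏ⁺¹ n ⟩
      (D Z ⊛ Zᵏ⁺¹) n + (Z ⊛ D Zᵏ⁺¹) n               ≡⟨ cong ((D Z ⊛ Zᵏ⁺¹) n +_) Z⊛DZᵏ⁺¹ ⟩
      (D Z ⊛ Zᵏ⁺¹) n + ι (suc k) * (D Z ⊛ Zᵏ⁺¹) n   ≡⟨ solve 2 (λ x c → x :+ c :* x := (con 1ℚ :+ c) :* x) refl _ (ι (suc k)) ⟩
      (1ℚ + ι (suc k)) * (D Z ⊛ Zᵏ⁺¹) n             ≡⟨ cong (_* (D Z ⊛ Zᵏ⁺¹) n) (sym (ι-+ 1 (suc k))) ⟩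
      ι (suc (suc k)) * (D Z ⊛ Zᵏ⁺¹) n ∎
      where
      Zᵏ⁺¹ = pow Z (suc k)
      Z⊛DZᵏ⁺¹ : (Z ⊛ D Zᵏ⁺¹) n ≡ ι (suc k) * (D Z ⊛ Zᵏ⁺¹) n
      Z⊛DZᵏ⁺¹ = begin
        (Z ⊛ D Zᵏ⁺¹) n                        ≡⟨ ⊛-cong {Z} (λ _ → refl) (D-pow k) n ⟩
        (Z ⊛ scale (ι (suc k)) (D Z ⊛ pow Z k)) n ≡⟨ ⊛-scaleʳ (ι (suc k)) Z (D Z ⊛ pow Z k) n ⟩
        ι (suc k) * (Z ⊛ (D Z ⊛ pow Z k)) n   ≡⟨ cong (ι (suc k) *_) (trans (sym (⊛-assoc Z (D Z) (pow Z k) n))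
                                                    (trans (⊛-congˡ (pow Z k) (⊛-comm Z (D Z)) n)
                                                           (⊛-assoc (D Z) Z (pow Z k) n))) ⟩
        ι (suc k) * (D Z ⊛ Zᵏ⁺¹) n ∎

    exp′-truncate : ∀ {u n} → u ℕ.≤ n → exp′ G u ≡ sumℚ (suc n) (λ j → invFact j * pow Z j u)
    exp′-truncate {u} {n} u≤n =
      trans (sumℚ-extend (n ℕ.∸ u) u _ (λ j u<j → trans (cong (invFact j *_) (pow-dropConst-low j u u<j)) (*-zeroʳ (invFact j))))
            (cong (λ m → sumℚ (suc m) (λ j → invFact j * pow Z j u)) (ℕP.m+[n∸m]≡n u≤n))

    -- the k-th term of D (exp G) is k!⁻¹ D(Gᵏ) = (k - 1)!⁻¹ G′ Gᵏ⁻¹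
    D-exp′-term : ∀ n j → ι (suc n) * (invFact (suc j) * pow Z (suc j) (suc n)) ≡ invFact j * (D Z ⊛ pow Z j) n
    D-exp′-term n j = begin
      ι (suc n) * (invFact (suc j) * pow Z (suc j) (suc n))
        ≡⟨ solve 3 (λ a b c → a :* (b :* c) := b :* (a :* c)) refl (ι (suc n)) (invFact (suc j)) (pow Z (suc j) (suc n)) ⟩
      invFact (suc j) * D (pow Z (suc j)) n          ≡⟨ cong (invFact (suc j) *_) (D-pow j n) ⟩
      invFact (suc j) * (ι (suc j) * (D Z ⊛ pow Z j) n) ≡⟨ sym (*-assoc (invFact (suc j)) _ _) ⟩
      invFact (suc j) * ι (suc j) * (D Z ⊛ pow Z j) n   ≡⟨ cong (_* (D Z ⊛ pow Z j) n) (invFact-suc j) ⟩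
      invFact j * (D Z ⊛ pow Z j) n ∎

    D-exp′ : D (exp′ G) ≗ (D G ⊛ exp′ G)
    D-exp′ n = begin
      ι (suc n) * sumℚ (suc (suc n)) (λ k → invFact k * pow Z k (suc n))
        ≡⟨ cong (ι (suc n) *_) (trans (sumℚ-suc (suc n) _)
             (cong (_+ sumℚ (suc n) (λ j → invFact (suc j) * pow Z (suc j) (suc n))) (*-zeroʳ (invFact 0)))) ⟩
      ι (suc n) * (0ℚ + sumℚ (suc n) (λ j → invFact (suc j) * pow Z (suc j) (suc n)))
        ≡⟨ trans (cong (ι (suc n) *_) (+-identityˡ _)) (sumℚ-*ˡ (suc n) (ι (suc n)) _) ⟩
      sumℚ (suc n) (λ j → ι (suc n) * (invFact (suc j) * pow Z (suc j) (suc n)))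
        ≡⟨ sumℚ-cong (suc n) (λ j → trans (D-exp′-term n j)
             (trans (cong (invFact j *_) (⊛-antidiag (D Z) (pow Z j) n)) (sym (antidiagℚ-*ˡ n (invFact j) _)))) ⟩
      sumℚ (suc n) (λ j → antidiagℚ n (λ t u → invFact j * (D G t * pow Z j u)))
        ≡⟨ sym (antidiagℚ-sumℚ n (suc n) _) ⟩
      antidiagℚ n (λ t u → sumℚ (suc n) (λ j → invFact j * (D G t * pow Z j u)))
        ≡⟨ antidiagℚ-cong n (λ t u t+u≡n → trans (sumℚ-cong (suc n) (λ j →
               solve 3 (λ a b c → a :* (b :* c) := b :* (a :* c)) refl (invFact j) (D G t) (pow Z j u)))
             (trans (sym (sumℚ-*ˡ (suc n) (D G t) _))
                    (cong (D G t *_) (sym (exp′-truncate (ℕP.≤-trans (ℕP.m≤n+m u t) (ℕP.≤-reflexive t+u≡n))))))) ⟩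
      antidiagℚ n (λ t u → D G t * exp′ G u)  ≡⟨ sym (⊛-antidiag (D G) (exp′ G) n) ⟩
      (D G ⊛ exp′ G) n ∎

  twoX : Series
  twoX = linX (ι 2)

  pow-twoX : ∀ k n → pow (dropConst twoX) k n ≡ (if k ℕ.≡ᵇ n then ι (2 ^ k) else 0ℚ)
  pow-twoX zero    zero    = refl
  pow-twoX zero    (suc n) = refl
  pow-twoX (suc k) zero    = trans (⊛-antidiag (dropConst twoX) (pow (dropConst twoX) k) 0) (*-zeroˡ (pow (dropConst twoX) k 0))
  pow-twoX (suc k) (suc m) = begin
    pow Z (suc k) (suc m)
      ≡⟨ ⊛-antidiag Z (pow Z k) (suc m) ⟩
    0ℚ * pow Z k (suc m) + antidiagℚ m (λ i j → Z (suc i) * pow Z k j)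
      ≡⟨ cong₂ _+_ (*-zeroˡ (pow Z k (suc m))) (only-linear m) ⟩
    0ℚ + ι 2 * pow Z k m
      ≡⟨ trans (+-identityˡ _) (cong (ι 2 *_) (pow-twoX k m)) ⟩
    ι 2 * (if k ℕ.≡ᵇ m then ι (2 ^ k) else 0ℚ)
      ≡⟨ double (k ℕ.≡ᵇ m) ⟩
    (if k ℕ.≡ᵇ m then ι (2 ^ suc k) else 0ℚ) ∎
    where
    Z = dropConst twoX
    only-linear : ∀ m → antidiagℚ m (λ i j → Z (suc i) * pow Z k j) ≡ ι 2 * pow Z k m
    only-linear zero    = refl
    only-linear (suc m) = trans (cong (ι 2 * pow Z k (suc m) +_)
      (trans (antidiagℚ-cong m (λ i j _ → *-zeroˡ (pow Z k j))) (antidiagℚ-0 m))) (+-identityʳ _)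
    double : ∀ b → ι 2 * (if b then ι (2 ^ k) else 0ℚ) ≡ (if b then ι (2 ^ suc k) else 0ℚ)
    double true  = sym (ι-* 2 (2 ^ k))
    double false = *-zeroʳ (ι 2)

  e2x-coeff : ∀ n → e2x n ≡ ι (2 ^ n) * invFact n
  e2x-coeff n = begin
    e2x n
      ≡⟨ expS≗exp′ twoX n ⟩
    sumℚ n (λ k → invFact k * pow (dropConst twoX) k n) + invFact n * pow (dropConst twoX) n n
      ≡⟨ cong₂ _+_ (trans (sumℚ-cong< n below) (sumℚ-zero n))
                   (cong (invFact n *_) (trans (pow-twoX n n) (cong (λ b → if b then ι (2 ^ n) else 0ℚ) (≡ᵇ-refl n)))) ⟩
    0ℚ + invFact n * ι (2 ^ n)
      ≡⟨ trans (+-identityˡ _) (*-comm (invFact n) _) ⟩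
    ι (2 ^ n) * invFact n ∎
    where
    below : ∀ k → k ℕ.< n → invFact k * pow (dropConst twoX) k n ≡ 0ℚ
    below k k<n rewrite pow-twoX k n | ≡ᵇ-false (ℕP.<⇒≢ k<n) = *-zeroʳ (invFact k)

module ClosedFormODE where

  open import Data.Nat as ℕ using (ℕ; zero; suc)
  open import Data.Integer using () renaming (+_ to ℤ+_)
  open import Data.Rational
  open import Data.Rational.Properties
  open import Data.Rational.Solver using (module +-*-Solver)
  open +-*-Solver using (solve; _:+_; _:*_; _:-_; :-_; _:=_; con)
  open import Relation.Binary.PropositionalEquality
  open import Relation.Binary.Bundles using (Setoid)
  open import Relation.Binary.Reasoning.Setoid (ℕ →-setoid ℚ)
  open Setoid (ℕ →-setoid ℚ) using () renaming (sym to ≗-sym)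
  open NatCast
  open PowerSeries
  open SeriesExp

  1⊕e2x : Series
  1⊕e2x = const 1ℚ ⊕ e2x

  expG expH correction : Series
  expG       = exp′ Gser
  expH       = exp′ Hser
  correction = const 1ℚ ⊖ scale ½ (integral (expS Hser ⊛ 1⊕e2x))

  closedForm≗ : closedForm ≗ expG ⊛ correction
  closedForm≗ = ⊛-congˡ correction (expS≗exp′ Gser)

  DGser⊕DHser≗0 : (D Gser ⊕ D Hser) ≗ zeroS
  DGser⊕DHser≗0 n = solve 5 (λ s l x z q → s :* (l :+ q :* (x :- z)) :+ s :* ((:- q) :* (x :- z) :- l) := con 0ℚ) refl
    (ι (suc n)) (linX ((ℤ+ 3) / 2) (suc n)) (e2x (suc n)) (const 1ℚ (suc n)) ((ℤ+ 1) / 4)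

  D[expG⊛expH]≗0 : D (expG ⊛ expH) ≗ zeroS
  D[expG⊛expH]≗0 = begin
    D (expG ⊛ expH)                                      ≈⟨ D-⊛ expG expH ⟩
    (D expG ⊛ expH) ⊕ (expG ⊛ D expH)                    ≈⟨ ⊕-cong (⊛-congˡ expH (D-exp′ Gser)) (⊛-congʳ expG (D-exp′ Hser)) ⟩
    ((D Gser ⊛ expG) ⊛ expH) ⊕ (expG ⊛ (D Hser ⊛ expH))  ≈⟨ ⊕-cong {(D Gser ⊛ expG) ⊛ expH} (λ _ → refl) swap ⟩
    ((D Gser ⊛ expG) ⊛ expH) ⊕ ((D Hser ⊛ expG) ⊛ expH)  ≈⟨ ⊛-⊕ˡ (D Gser ⊛ expG) (D Hser ⊛ expG) expH ⟨
    ((D Gser ⊛ expG) ⊕ (D Hser ⊛ expG)) ⊛ expH           ≈⟨ ⊛-congˡ expH (≗-sym (⊛-⊕ˡ (D Gser) (D Hser) expG)) ⟩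
    ((D Gser ⊕ D Hser) ⊛ expG) ⊛ expH                    ≈⟨ ⊛-zeroˡ expH (⊛-zeroˡ expG DGser⊕DHser≗0) ⟩
    zeroS ∎
    where
    swap : (expG ⊛ (D Hser ⊛ expH)) ≗ ((D Hser ⊛ expG) ⊛ expH)
    swap = begin
      expG ⊛ (D Hser ⊛ expH)  ≈⟨ ⊛-assoc expG (D Hser) expH ⟨
      (expG ⊛ D Hser) ⊛ expH  ≈⟨ ⊛-congˡ expH (⊛-comm expG (D Hser)) ⟩
      (D Hser ⊛ expG) ⊛ expH ∎

  expG⊛expH≗1 : (expG ⊛ expH) ≗ const 1ℚ
  expG⊛expH≗1 zero    = refl
  expG⊛expH≗1 (suc n) = D≡0⇒coeff≡0 (expG ⊛ expH) n (D[expG⊛expH]≗0 n)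

  D-correction : D correction ≗ scale -½ (expH ⊛ 1⊕e2x)
  D-correction m = trans
    (solve 4 (λ a b c x → a :* (con 0ℚ :- b :* (c :* x)) := (:- b) :* x :* (c :* a)) refl
       (ι (suc m)) ½ (recip (suc m)) ((expS Hser ⊛ 1⊕e2x) m))
    (trans (cong (-½ * (expS Hser ⊛ 1⊕e2x) m *_) (recip-inverse (suc m)))
      (trans (*-identityʳ _) (cong (-½ *_) (⊛-congˡ 1⊕e2x (expS≗exp′ Hser) m))))

  closedForm-ODE : D closedForm ≗ (D Gser ⊛ closedForm) ⊕ scale -½ 1⊕e2x
  closedForm-ODE = begin
    D closedForm                                                  ≈⟨ D-cong closedForm≗ ⟩
    D (expG ⊛ correction)                                         ≈⟨ D-⊛ expG correction ⟩
    (D expG ⊛ correction) ⊕ (expG ⊛ D correction)                 ≈⟨ ⊕-cong (⊛-congˡ correction (D-exp′ Gser))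
                                                                            (⊛-congʳ expG D-correction) ⟩
    ((D Gser ⊛ expG) ⊛ correction) ⊕ (expG ⊛ scale -½ (expH ⊛ 1⊕e2x))
                                                                  ≈⟨ ⊕-cong (⊛-assoc (D Gser) expG correction)
                                                                            (⊛-scaleʳ -½ expG (expH ⊛ 1⊕e2x)) ⟩
    (D Gser ⊛ (expG ⊛ correction)) ⊕ scale -½ (expG ⊛ (expH ⊛ 1⊕e2x))
                                                                  ≈⟨ ⊕-cong (⊛-congʳ (D Gser) (≗-sym closedForm≗))
                                                                            (λ n → cong (-½ *_) (expG⊛[expH⊛1⊕e2x] n)) ⟩
    (D Gser ⊛ closedForm) ⊕ scale -½ 1⊕e2x ∎
    where
    expG⊛[expH⊛1⊕e2x] : (expG ⊛ (expH ⊛ 1⊕e2x)) ≗ 1⊕e2x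
    expG⊛[expH⊛1⊕e2x] = begin
      expG ⊛ (expH ⊛ 1⊕e2x)   ≈⟨ ⊛-assoc expG expH 1⊕e2x ⟨
      (expG ⊛ expH) ⊛ 1⊕e2x   ≈⟨ ⊛-congˡ 1⊕e2x expG⊛expH≗1 ⟩
      const 1ℚ ⊛ 1⊕e2x        ≈⟨ ⊛-unitˡ 1⊕e2x ⟩
      1⊕e2x ∎

module IncreasingODE where

  open import Data.Nat as ℕ using (ℕ; zero; suc; _!; _^_)
  import Data.Nat.Properties as ℕP
  open import Data.Nat.Properties using (_!≢0)
  open import Data.Rational
  open import Data.Rational.Properties
  open import Data.Rational.Solver using (module +-*-Solver)
  open +-*-Solver using (solve; _:+_; _:*_; _:-_; :-_; _:=_; con)
  open import Relation.Binary.PropositionalEquality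
  open ≡-Reasoning
  open NatSum using (sumℕ-cong)
  open Binomial
  open Standardisation using (inc≡completions)
  open RankRecurrence using (total-recurrence)
  open NatCast
  open PowerSeries
  open SeriesExp
  open ClosedFormODE

  inc-recurrence : ∀ m →
    inc (suc (suc m)) ≡ 2 ℕ.* inc (suc m) ℕ.+ sumℕ m (λ j → binom (suc m) (suc j) ℕ.* 2 ^ j ℕ.* inc (m ℕ.∸ j))
  inc-recurrence m = trans (inc≡completions (suc (suc m))) (trans (total-recurrence m)
    (sym (cong₂ ℕ._+_ (cong (2 ℕ.*_) (inc≡completions (suc m)))
                      (sumℕ-cong m (λ j → cong (binom (suc m) (suc j) ℕ.* 2 ^ j ℕ.*_) (inc≡completions (m ℕ.∸ j)))))))

  convolution : ℕ → ℚ
  convolution m = sumℚ m (λ j → ι (binom (suc m) (suc j)) * ι (2 ^ j) * ι (inc (m ℕ.∸ j)))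

  inc-recurrenceℚ : ∀ m → ι (inc (suc (suc m))) ≡ ι 2 * ι (inc (suc m)) + convolution m
  inc-recurrenceℚ m =
    trans (cong ι (inc-recurrence m)) (trans (ι-+ (2 ℕ.* inc (suc m)) (sumℕ m term)) (cong₂ _+_ (ι-* 2 (inc (suc m)))
      (trans (ι-sumℕ m term) (sumℚ-cong m (λ j → trans (ι-* (binom (suc m) (suc j) ℕ.* 2 ^ j) (inc (m ℕ.∸ j)))
                                                      (cong (_* ι (inc (m ℕ.∸ j))) (ι-* (binom (suc m) (suc j)) (2 ^ j))))))))
    where
    term : ℕ → ℕ
    term j = binom (suc m) (suc j) ℕ.* 2 ^ j ℕ.* inc (m ℕ.∸ j)

  Iseries-coeff : ∀ n → Iseries n ≡ ι (inc n) * invFact n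
  Iseries-coeff n = /-≡ι*recip (inc n) (n !) {{n !≢0}}

  D-Iseries-suc : ∀ m → D Iseries (suc m) ≡ invFact (suc m) * (ι 2 * ι (inc (suc m)) + convolution m)
  D-Iseries-suc m = begin
    ι (suc (suc m)) * Iseries (suc (suc m))
      ≡⟨ cong (ι (suc (suc m)) *_) (Iseries-coeff (suc (suc m))) ⟩
    ι (suc (suc m)) * (ι (inc (suc (suc m))) * invFact (suc (suc m)))
      ≡⟨ solve 3 (λ s x f → s :* (x :* f) := x :* (f :* s)) refl
           (ι (suc (suc m))) (ι (inc (suc (suc m)))) (invFact (suc (suc m))) ⟩
    ι (inc (suc (suc m))) * (invFact (suc (suc m)) * ι (suc (suc m)))
      ≡⟨ cong₂ _*_ (inc-recurrenceℚ m) (invFact-suc (suc m)) ⟩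
    (ι 2 * ι (inc (suc m)) + convolution m) * invFact (suc m)
      ≡⟨ *-comm _ (invFact (suc m)) ⟩
    invFact (suc m) * (ι 2 * ι (inc (suc m)) + convolution m) ∎

  DGser-suc : ∀ m → D Gser (suc m) ≡ ι (2 ^ m) * invFact (suc m)
  DGser-suc m = begin
    ι (suc (suc m)) * (0ℚ + recip 4 * (e2x (suc (suc m)) - 0ℚ))
      ≡⟨ cong (λ z → ι (suc (suc m)) * (0ℚ + recip 4 * (z - 0ℚ))) (e2x-coeff (suc (suc m))) ⟩
    ι (suc (suc m)) * (0ℚ + recip 4 * (ι (2 ^ suc (suc m)) * invFact (suc (suc m)) - 0ℚ))
      ≡⟨ cong (λ z → ι (suc (suc m)) * (0ℚ + recip 4 * (z * invFact (suc (suc m)) - 0ℚ)))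
              (trans (cong ι (sym (ℕP.*-assoc 2 2 (2 ^ m)))) (ι-* 4 (2 ^ m))) ⟩
    ι (suc (suc m)) * (0ℚ + recip 4 * (ι 4 * ι (2 ^ m) * invFact (suc (suc m)) - 0ℚ))
      ≡⟨ solve 5 (λ s q f t x → s :* (con 0ℚ :+ q :* (f :* t :* x :- con 0ℚ)) := (q :* f) :* t :* (x :* s)) refl
           (ι (suc (suc m))) (recip 4) (ι 4) (ι (2 ^ m)) (invFact (suc (suc m))) ⟩
    recip 4 * ι 4 * ι (2 ^ m) * (invFact (suc (suc m)) * ι (suc (suc m)))
      ≡⟨ cong₂ (λ u v → u * ι (2 ^ m) * v) (recip-inverse 4) (invFact-suc (suc m)) ⟩
    1ℚ * ι (2 ^ m) * invFact (suc m)
      ≡⟨ cong (_* invFact (suc m)) (*-identityˡ (ι (2 ^ m))) ⟩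
    ι (2 ^ m) * invFact (suc m) ∎

  DGser⊛Iseries-term : ∀ m i → i ℕ.< m → D Gser (suc i) * Iseries (m ℕ.∸ i)
    ≡ invFact (suc m) * (ι (binom (suc m) (suc i)) * ι (2 ^ i) * ι (inc (m ℕ.∸ i)))
  DGser⊛Iseries-term m i i<m = begin
    D Gser (suc i) * Iseries (m ℕ.∸ i)
      ≡⟨ cong₂ _*_ (DGser-suc i) (Iseries-coeff (m ℕ.∸ i)) ⟩
    ι (2 ^ i) * invFact (suc i) * (ι (inc (m ℕ.∸ i)) * invFact (m ℕ.∸ i))
      ≡⟨ solve 4 (λ p a x b → p :* a :* (x :* b) := (a :* b) :* p :* x) refl
           (ι (2 ^ i)) (invFact (suc i)) (ι (inc (m ℕ.∸ i))) (invFact (m ℕ.∸ i)) ⟩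
    invFact (suc i) * invFact (suc m ℕ.∸ suc i) * ι (2 ^ i) * ι (inc (m ℕ.∸ i))
      ≡⟨ cong (λ z → z * ι (2 ^ i) * ι (inc (m ℕ.∸ i)))
              (sym (binom-invFact (suc m) (suc i) (ℕ.s≤s (ℕP.<⇒≤ i<m)))) ⟩
    ι (binom (suc m) (suc i)) * invFact (suc m) * ι (2 ^ i) * ι (inc (m ℕ.∸ i))
      ≡⟨ solve 4 (λ b f p x → b :* f :* p :* x := f :* (b :* p :* x)) refl
           (ι (binom (suc m) (suc i))) (invFact (suc m)) (ι (2 ^ i)) (ι (inc (m ℕ.∸ i))) ⟩
    invFact (suc m) * (ι (binom (suc m) (suc i)) * ι (2 ^ i) * ι (inc (m ℕ.∸ i))) ∎

  DGser⊛Iseries-suc : ∀ m →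
    (D Gser ⊛ Iseries) (suc m) ≡ ι 2 * Iseries (suc m) + invFact (suc m) * (convolution m + ι (2 ^ m))
  DGser⊛Iseries-suc m = begin
    (D Gser ⊛ Iseries) (suc m)
      ≡⟨ ⊛-antidiag (D Gser) Iseries (suc m) ⟩
    ι 2 * Iseries (suc m) + antidiagℚ m (λ i j → D Gser (suc i) * Iseries j)
      ≡⟨ cong (ι 2 * Iseries (suc m) +_) (sym (sumℚ-antidiag m _)) ⟩
    ι 2 * Iseries (suc m) + (sumℚ m (λ i → D Gser (suc i) * Iseries (m ℕ.∸ i)) + D Gser (suc m) * Iseries (m ℕ.∸ m))
      ≡⟨ cong (ι 2 * Iseries (suc m) +_) (cong₂ _+_
           (trans (sumℚ-cong< m (DGser⊛Iseries-term m)) (sym (sumℚ-*ˡ m (invFact (suc m)) _))) last) ⟩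
    ι 2 * Iseries (suc m) + (invFact (suc m) * convolution m + invFact (suc m) * ι (2 ^ m))
      ≡⟨ cong (ι 2 * Iseries (suc m) +_) (sym (*-distribˡ-+ (invFact (suc m)) _ _)) ⟩
    ι 2 * Iseries (suc m) + invFact (suc m) * (convolution m + ι (2 ^ m)) ∎
    where
    last : D Gser (suc m) * Iseries (m ℕ.∸ m) ≡ invFact (suc m) * ι (2 ^ m)
    last = begin
      D Gser (suc m) * Iseries (m ℕ.∸ m) ≡⟨ cong (λ k → D Gser (suc m) * Iseries k) (ℕP.n∸n≡0 m) ⟩
      D Gser (suc m) * 1ℚ               ≡⟨ *-identityʳ (D Gser (suc m)) ⟩
      D Gser (suc m)                    ≡⟨ trans (DGser-suc m) (*-comm (ι (2 ^ m)) _) ⟩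
      invFact (suc m) * ι (2 ^ m) ∎

  1⊕e2x-suc : ∀ m → 1⊕e2x (suc m) ≡ ι 2 * ι (2 ^ m) * invFact (suc m)
  1⊕e2x-suc m = trans (+-identityˡ _) (trans (e2x-coeff (suc m)) (cong (_* invFact (suc m)) (ι-* 2 (2 ^ m))))

  Iseries-ODE : D Iseries ≗ (D Gser ⊛ Iseries) ⊕ scale -½ 1⊕e2x
  Iseries-ODE zero    = refl
  Iseries-ODE (suc m) = begin
    D Iseries (suc m)
      ≡⟨ D-Iseries-suc m ⟩
    f * (ι 2 * X + S)
      ≡⟨ solve 5 (λ f x s p h → f :* (con (ι 2) :* x :+ s)
                    := con (ι 2) :* (x :* f) :+ f :* (s :+ p) :+ (:- h) :* (con (ι 2) :* p :* f)
                       :+ (h :* con (ι 2) :- con 1ℚ) :* p :* f) refl f X S (ι (2 ^ m)) ½ ⟩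
    ι 2 * (X * f) + f * (S + ι (2 ^ m)) + -½ * (ι 2 * ι (2 ^ m) * f) + (½ * ι 2 - 1ℚ) * ι (2 ^ m) * f
      ≡⟨ cong₂ _+_ (cong₂ (λ x y → ι 2 * x + f * (S + ι (2 ^ m)) + -½ * y)
                          (sym (Iseries-coeff (suc m))) (sym (1⊕e2x-suc m)))
                   (trans (cong (λ z → z * ι (2 ^ m) * f) (trans (cong (_- 1ℚ) (recip-inverse 2)) (+-inverseʳ 1ℚ)))
                          (trans (cong (_* f) (*-zeroˡ (ι (2 ^ m)))) (*-zeroˡ f))) ⟩
    ι 2 * Iseries (suc m) + f * (S + ι (2 ^ m)) + -½ * 1⊕e2x (suc m) + 0ℚ
      ≡⟨ trans (+-identityʳ _) (cong (_+ -½ * 1⊕e2x (suc m)) (sym (DGser⊛Iseries-suc m))) ⟩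
    (D Gser ⊛ Iseries) (suc m) + -½ * 1⊕e2x (suc m) ∎
    where
    f = invFact (suc m)
    X = ι (inc (suc m))
    S = convolution m

open import Data.Nat using (ℕ; suc; _≤_; _+_; _*_; _^_; _∸_; s≤s; z≤n)
open import Data.Nat.Combinatorics using (_C_)
open import Data.Product using (_×_; _,_)
open import Relation.Binary.PropositionalEquality using (_≡_; refl; trans; cong)
open Binomial using (binom≡C)
open Standardisation using (inc≡completions)
open import Data.Rational using (-½)
open PowerSeries using (D; linearODE-unique)
open ClosedFormODE using (1⊕e2x; closedForm-ODE)
open IncreasingODE using (inc-recurrence; Iseries-ODE)

inc-recurrence-C : (n : ℕ) → 1 ≤ n →
  inc (suc n) ≡ 2 * inc n + sumℕ (n ∸ 1) (λ j → (n C suc j) * 2 ^ j * inc (n ∸ suc j))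
inc-recurrence-C (suc m) (s≤s z≤n) = trans (inc-recurrence m) (cong (2 * inc (suc m) +_)
  (NatSum.sumℕ-cong m (λ j → cong (λ c → c * 2 ^ j * inc (m ∸ j)) (binom≡C (suc m) (suc j)))))

corollary2p3 :
    ((n : ℕ) → Iseries n ≡ closedForm n)
    × (inc 0 ≡ 1 × inc 1 ≡ 1 × inc 2 ≡ 2 × inc 3 ≡ 6 × inc 4 ≡ 24
       × inc 5 ≡ 112 × inc 6 ≡ 584 × inc 7 ≡ 3376)
    × ((n : ℕ) → 1 ≤ n →
         inc (suc n) ≡ 2 * inc n + sumℕ (n ∸ 1) (λ j → (n C suc j) * 2 ^ j * inc (n ∸ suc j)))
corollary2p3 =
    linearODE-unique (D Gser) (scale -½ 1⊕e2x) Iseries closedForm refl Iseries-ODE closedForm-ODE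
    -- evaluated through the rank recursion rather than by enumerating all kᵏ words
  , ( inc≡completions 0 , inc≡completions 1 , inc≡completions 2 , inc≡completions 3
    , inc≡completions 4 , inc≡completions 5 , inc≡completions 6 , inc≡completions 7 )
  , inc-recurrence-C
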